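{- For every integer $n\ge 1$, \[ \sum_{\mathsf{p} \in \mathsf{Dyck}(n)} \, \prod_{(a,b) \in \mathsf{p}}\frac{1}{2b+1} \, = \, \frac{E_{2n+1}}{(2n+1)!}\,, \] where the product is over all $2n+1$ lattice points $(a,b)$, $a=0,1,\dots,2n$, of the path $\mathsf{p}$.
   Context: $\mathsf{Dyck}(n)$ is the set of Dyck paths of length $2n$: lattice paths from $(0,0)$ to $(2n,0)$ with steps $(1,1)$ and $(1,-1)$ that never go below the $x$-axis; a path is identified with its set of lattice points $(a,b)$. $\mathsf{Alt}(m)$ is the set of alternating permutations $\sigma\in S_m$, i.e. $\sigma(1)<\sigma(2)>\sigma(3)<\sigma(4)>\cdots$, and $E_m=|\mathsf{Alt}(m)|$ is the $m$-th Euler number. -}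

module Defs where

open import Data.Bool using (Bool; true; false)
open import Data.Nat as ℕ using (ℕ; zero; suc; _<_; _!)
open import Data.Nat.Properties using (_!≢0)
import Data.Nat.Properties as ℕP
open import Data.Integer as ℤ using (ℤ; +_; ∣_∣)
import Data.Integer.Properties as ℤP
open import Data.Rational as ℚ using (ℚ; _/_)
open import Data.Fin using (Fin; toℕ)
open import Data.List using (List; []; _∷_; map; allFin; concatMap; filter; length; foldr)
open import Data.List.Relation.Unary.All using (All)
open import Data.List.Relation.Unary.All as All using (all?)
open import Data.List.Relation.Unary.Unique.Propositional using (Unique)
open import Data.List.Relation.Unary.Unique.DecPropositional using (unique?)
open import Data.Fin.Properties using () renaming (_≟_ to _≟ᶠ_)
open import Data.Unit using (⊤; tt)
open import Data.Product using (_×_; _,_)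
open import Relation.Nullary using (Dec; yes; no)
open import Relation.Nullary.Decidable using (_×-dec_)
open import Relation.Binary.PropositionalEquality using (_≡_)

words : {A : Set} → List A → ℕ → List (List A)
words xs zero    = [] ∷ []
words xs (suc k) = concatMap (λ x → map (x ∷_) (words xs k)) xs

-- Dyck paths.  A path of length 2n is a word of 2n steps
-- (true = up step (1,1), false = down step (1,-1)).

step : Bool → ℤ
step true  = ℤ.+ 1
step false = ℤ.-[1+ 0 ]

-- heights of the lattice points of the path, starting at height h:
-- the list [b_0, b_1, ..., b_len] (len+1 points)
heights : ℤ → List Bool → List ℤ
heights h []      = h ∷ []
heights h (u ∷ s) = h ∷ heights (h ℤ.+ step u) s

endHeight : ℤ → List Bool → ℤ
endHeight h []      = h
endHeight h (u ∷ s) = endHeight (h ℤ.+ step u) s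

IsDyck : List Bool → Set
IsDyck s = All (ℤ.+ 0 ℤ.≤_) (heights (ℤ.+ 0) s) × endHeight (ℤ.+ 0) s ≡ ℤ.+ 0

isDyck? : (s : List Bool) → Dec (IsDyck s)
isDyck? s = all? (ℤ.+ 0 ℤ.≤?_) (heights (ℤ.+ 0) s) ×-dec (endHeight (ℤ.+ 0) s ℤ.≟ ℤ.+ 0)

Dyck : ℕ → List (List Bool)
Dyck n = filter isDyck? (words (true ∷ false ∷ []) (2 ℕ.* n))

sumℚ : List ℚ → ℚ
sumℚ = foldr ℚ._+_ ℚ.0ℚ

prodℚ : List ℚ → ℚ
prodℚ = foldr ℚ._*_ ℚ.1ℚ

weight : List Bool → ℚ
weight s = prodℚ (map (λ b → ℤ.+ 1 / suc (2 ℕ.* ∣ b ∣)) (heights (ℤ.+ 0) s))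

-- Alternating permutations.  A permutation σ ∈ S_m is given in one-line
-- notation as the list [σ(1), ..., σ(m)] of elements of Fin m without
-- repetitions (an injective map Fin m → Fin m).

mutual
  Up : List ℕ → Set
  Up (x ∷ y ∷ r) = x < y × Down (y ∷ r)
  Up _           = ⊤

  Down : List ℕ → Set
  Down (x ∷ y ∷ r) = y < x × Up (y ∷ r)
  Down _           = ⊤

mutual
  up? : (xs : List ℕ) → Dec (Up xs)
  up? []          = yes tt
  up? (x ∷ [])    = yes tt
  up? (x ∷ y ∷ r) = (x ℕ.<? y) ×-dec down? (y ∷ r)

  down? : (xs : List ℕ) → Dec (Down xs)
  down? []          = yes tt
  down? (x ∷ [])    = yes tt
  down? (x ∷ y ∷ r) = (y ℕ.<? x) ×-dec up? (y ∷ r)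

IsAltPerm : (m : ℕ) → List (Fin m) → Set
IsAltPerm m σ = Unique σ × Up (map toℕ σ)

isAltPerm? : (m : ℕ) → (σ : List (Fin m)) → Dec (IsAltPerm m σ)
isAltPerm? m σ = unique? _≟ᶠ_ σ ×-dec up? (map toℕ σ)

Alt : (m : ℕ) → List (List (Fin m))
Alt m = filter (isAltPerm? m) (words (allFin m) m)

E : ℕ → ℕ
E m = length (Alt m)

eulerRatio : ℕ → ℚ
eulerRatio m = (ℤ.+ E m / (m !)) {{m !≢0}}

module Submission where

open import Defs
open import Data.Nat using (ℕ; _≥_; suc; _*_)
open import Data.List using (map)
open import Relation.Binary.PropositionalEquality using (_≡_)

open import Data.Bool using (Bool; true; false; not; if_then_else_; _∧_; T)
open import Data.Bool.Properties using (not-involutive; ∧-identityʳ; ∧-zeroʳ)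
open import Data.Empty using (⊥-elim)
open import Data.Fin using (Fin; toℕ)
import Data.Fin.Properties as FP
open import Data.Integer as ℤ using (ℤ; +_; -[1+_]; ∣_∣)
import Data.Integer.Properties as ℤP
open import Data.List using (List; []; _∷_; filter; concatMap; _++_; length; allFin; tabulate)
import Data.List.Properties as LP
open import Data.List.Membership.Propositional using (_∈_; _∉_)
open import Data.List.Relation.Unary.All as All using (All; all?; []; _∷_)
open import Data.List.Relation.Unary.AllPairs using ([]; _∷_)
open import Data.List.Relation.Unary.Any using (here; there)
open import Data.List.Relation.Unary.Unique.Propositional using (Unique)
open import Data.List.Relation.Unary.Unique.DecPropositional using (unique?)
open import Data.Nat as ℕ using (zero; _∸_; _!; _<_; _≤_; z≤n; s≤s; _<?_; _≟_)
open import Data.Nat.ListAction using (sum)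
import Data.Nat.Properties as ℕP
open import Algebra.Properties.CommutativeSemigroup ℕP.+-commutativeSemigroup using (interchange)
open import Data.Product using (_×_; _,_)
open import Data.Rational as ℚ using (ℚ; _/_; 0ℚ; 1ℚ; ½; fromℚᵘ)
import Data.Rational.Properties as ℚP
open import Data.Rational.Solver using (module +-*-Solver)
open import Data.Rational.Unnormalised as ℚᵘ using (ℚᵘ; mkℚᵘ; *≡*)
import Data.Rational.Unnormalised.Properties as ℚᵘP
open import Data.Unit using (tt)
open import Function using (_∘_; id; _⇔_; mk⇔; Equivalence)
open import Level using (0ℓ)
open import Relation.Binary.Definitions using (tri<; tri≈; tri>)
open import Relation.Binary.PropositionalEquality using (refl; sym; trans; cong; cong₂; _≢_; module ≡-Reasoning)
open import Relation.Nullary using (Dec; yes; no; does)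
open import Relation.Nullary.Decidable using (_×-dec_; map′; T?; dec-true; dec-false)
open import Relation.Nullary.Reflects using (Reflects; ofʸ; ofⁿ; fromEquivalence)
open import Relation.Unary using (Pred; Decidable)

open +-*-Solver using (solve; _:=_; _:+_; _:*_; _:-_; :-_; con)

-- Both sides are the coefficient a_n of x^(2n+1) in tan x: we show that each satisfies a₀ = 1 and
-- (2m+3) a_(m+1) = Σ_(i+j=m) a_i a_j, the coefficient form of tan′ = 1 + tan², which determines it.
--
-- Let W_h(L) be the total weight of the nonnegative paths of length L from height h down
-- to 0, so that (2h+1) W_h(L+1) = W_(h+1)(L) + W_(h-1)(L). Together with the convolutions
-- C_h(L+1) = Σ_(i+j=L) W_0(i) W_h(j) it satisfies a linear identity, proved by induction on L for all
-- heights at once, whose case h = 0 is (L+2) W_0(L+1) = C_0(L); odd lengths contribute nothing.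
--
-- Building an alternating permutation letter by letter, the number of completions only
-- depends on how many unused letters lie on the side where the next letter must go, and this count
-- obeys the Entringer recurrence, so E_m = E(m,m). The generating function
-- f(x,y) = Σ E(m+n,n) x^m y^n / (m! n!) satisfies the boustrophedon equation ∂_y f = ∂_x f + f(y,x),
-- whose solutions are determined by their values on y = 0. Each term of ∂_x f + ∂_y f − f(-y,-x) − 2 f tan(x+y)
-- solves it and the whole vanishes on y = 0, so this is 0; on x = 0 its odd part is the recurrence above.

fromℚᵘ-homo-+ : ∀ p q → fromℚᵘ (p ℚᵘ.+ q) ≡ fromℚᵘ p ℚ.+ fromℚᵘ q
fromℚᵘ-homo-+ p q = ℚP.toℚᵘ-injective (ℚᵘP.≃-trans (ℚP.toℚᵘ-fromℚᵘ (p ℚᵘ.+ q))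
  (ℚᵘP.≃-sym (ℚᵘP.≃-trans (ℚP.toℚᵘ-homo-+ (fromℚᵘ p) (fromℚᵘ q))
    (ℚᵘP.+-cong (ℚP.toℚᵘ-fromℚᵘ p) (ℚP.toℚᵘ-fromℚᵘ q)))))

fromℚᵘ-homo-* : ∀ p q → fromℚᵘ (p ℚᵘ.* q) ≡ fromℚᵘ p ℚ.* fromℚᵘ q
fromℚᵘ-homo-* p q = ℚP.toℚᵘ-injective (ℚᵘP.≃-trans (ℚP.toℚᵘ-fromℚᵘ (p ℚᵘ.* q))
  (ℚᵘP.≃-sym (ℚᵘP.≃-trans (ℚP.toℚᵘ-homo-* (fromℚᵘ p) (fromℚᵘ q))
    (ℚᵘP.*-cong (ℚP.toℚᵘ-fromℚᵘ p) (ℚP.toℚᵘ-fromℚᵘ q)))))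

fromℚᵘ-mkℚᵘ-≡ : ∀ a b c d → a ℤ.* + suc d ≡ c ℤ.* + suc b → fromℚᵘ (mkℚᵘ a b) ≡ fromℚᵘ (mkℚᵘ c d)
fromℚᵘ-mkℚᵘ-≡ a b c d eq = ℚP.fromℚᵘ-cong {mkℚᵘ a b} {mkℚᵘ c d} (*≡* eq)

fromℕ : ℕ → ℚ
fromℕ n = + n / 1

fromℕ-+ : ∀ m n → fromℕ (m ℕ.+ n) ≡ fromℕ m ℚ.+ fromℕ n
fromℕ-+ m n = trans (fromℚᵘ-mkℚᵘ-≡ (+ (m ℕ.+ n)) 0 (+ m ℤ.* + 1 ℤ.+ + n ℤ.* + 1) 0 (cong (ℤ._* + 1) numerators))
  (fromℚᵘ-homo-+ (mkℚᵘ (+ m) 0) (mkℚᵘ (+ n) 0))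
  where
  numerators : + (m ℕ.+ n) ≡ + m ℤ.* + 1 ℤ.+ + n ℤ.* + 1
  numerators = sym (trans (cong₂ ℤ._+_ (ℤP.*-identityʳ (+ m)) (ℤP.*-identityʳ (+ n))) (ℤP.pos-+ m n))

fromℕ-* : ∀ m n → fromℕ (m ℕ.* n) ≡ fromℕ m ℚ.* fromℕ n
fromℕ-* m n = trans (fromℚᵘ-mkℚᵘ-≡ (+ (m ℕ.* n)) 0 (+ m ℤ.* + n) 0 (cong (ℤ._* + 1) (ℤP.pos-* m n)))
  (fromℚᵘ-homo-* (mkℚᵘ (+ m) 0) (mkℚᵘ (+ n) 0))

fromℕ-suc : ∀ n → fromℕ (suc n) ≡ 1ℚ ℚ.+ fromℕ n
fromℕ-suc = fromℕ-+ 1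

i/n*n≡i : ∀ i n .{{_ : ℕ.NonZero n}} → (i / n) ℚ.* fromℕ n ≡ i / 1
i/n*n≡i i (suc k) = trans (sym (fromℚᵘ-homo-* (mkℚᵘ i k) (mkℚᵘ (+ suc k) 0)))
  (fromℚᵘ-mkℚᵘ-≡ (i ℤ.* + suc k) (k ℕ.* 1) i 0
    (trans (ℤP.*-identityʳ _) (cong (λ d → i ℤ.* + suc d) (sym (ℕP.*-identityʳ k)))))

*-cancelˡ-fromℕ : ∀ n .{{_ : ℕ.NonZero n}} {x y} → fromℕ n ℚ.* x ≡ fromℕ n ℚ.* y → x ≡ y
*-cancelˡ-fromℕ n {x} {y} eq = begin
  x                                ≡⟨ solve 1 (λ x → x := con 1ℚ :* x) refl x ⟩
  1ℚ ℚ.* x                         ≡⟨ cong (ℚ._* x) (sym (i/n*n≡i (+ 1) n)) ⟩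
  (+ 1 / n) ℚ.* fromℕ n ℚ.* x      ≡⟨ ℚP.*-assoc (+ 1 / n) _ x ⟩
  (+ 1 / n) ℚ.* (fromℕ n ℚ.* x)    ≡⟨ cong ((+ 1 / n) ℚ.*_) eq ⟩
  (+ 1 / n) ℚ.* (fromℕ n ℚ.* y)    ≡⟨ ℚP.*-assoc (+ 1 / n) _ y ⟨
  (+ 1 / n) ℚ.* fromℕ n ℚ.* y      ≡⟨ cong (ℚ._* y) (i/n*n≡i (+ 1) n) ⟩
  1ℚ ℚ.* y                         ≡⟨ solve 1 (λ y → con 1ℚ :* y := y) refl y ⟩
  y                                ∎
  where open ≡-Reasoning

antidiag : (ℕ → ℕ → ℚ) → ℕ → ℚ
antidiag F zero    = F 0 0
antidiag F (suc m) = F 0 (suc m) ℚ.+ antidiag (λ i j → F (suc i) j) m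

antidiag-cong : ∀ {F G : ℕ → ℕ → ℚ} m → (∀ i j → i ℕ.+ j ≡ m → F i j ≡ G i j) →
                antidiag F m ≡ antidiag G m
antidiag-cong zero    eq = eq 0 0 refl
antidiag-cong (suc m) eq =
  cong₂ ℚ._+_ (eq 0 (suc m) refl) (antidiag-cong m (λ i j i+j≡m → eq (suc i) j (cong suc i+j≡m)))

antidiag-+ : ∀ (F G : ℕ → ℕ → ℚ) m →
             antidiag (λ i j → F i j ℚ.+ G i j) m ≡ antidiag F m ℚ.+ antidiag G m
antidiag-+ F G zero    = refl
antidiag-+ F G (suc m) =
  trans (cong (F 0 (suc m) ℚ.+ G 0 (suc m) ℚ.+_) (antidiag-+ (λ i → F (suc i)) (λ i → G (suc i)) m))
    (solve 4 (λ a b c d → (a :+ b) :+ (c :+ d) := (a :+ c) :+ (b :+ d)) refl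
      (F 0 (suc m)) (G 0 (suc m)) (antidiag (λ i → F (suc i)) m) (antidiag (λ i → G (suc i)) m))

antidiag-*ˡ : ∀ (c : ℚ) (F : ℕ → ℕ → ℚ) m → antidiag (λ i j → c ℚ.* F i j) m ≡ c ℚ.* antidiag F m
antidiag-*ˡ c F zero    = refl
antidiag-*ˡ c F (suc m) =
  trans (cong (c ℚ.* F 0 (suc m) ℚ.+_) (antidiag-*ˡ c (λ i → F (suc i)) m)) (sym (ℚP.*-distribˡ-+ c _ _))

antidiag-snoc : ∀ (F : ℕ → ℕ → ℚ) m →
                antidiag F (suc m) ≡ antidiag (λ i j → F i (suc j)) m ℚ.+ F (suc m) 0
antidiag-snoc F zero    = refl
antidiag-snoc F (suc m) =
  trans (cong (F 0 (suc (suc m)) ℚ.+_) (antidiag-snoc (λ i → F (suc i)) m))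
    (sym (ℚP.+-assoc (F 0 (suc (suc m))) _ (F (suc (suc m)) 0)))

antidiag-interchange : ∀ (H : ℕ → ℕ → ℕ → ℕ → ℚ) m n →
  antidiag (λ i i′ → antidiag (λ j j′ → H i i′ j j′) n) m ≡
  antidiag (λ j j′ → antidiag (λ i i′ → H i i′ j j′) m) n
antidiag-interchange H zero    n = refl
antidiag-interchange H (suc m) n =
  trans (cong (antidiag (H 0 (suc m)) n ℚ.+_) (antidiag-interchange (λ i → H (suc i)) m n))
    (sym (antidiag-+ (H 0 (suc m)) _ n))

antidiag-degree : ∀ (F : ℕ → ℕ → ℚ) m →
  fromℕ m ℚ.* antidiag F m ≡ antidiag (λ i j → (fromℕ i ℚ.+ fromℕ j) ℚ.* F i j) m
antidiag-degree F zero    = solve 1 (λ x → con 0ℚ :* x := (con 0ℚ :+ con 0ℚ) :* x) refl (F 0 0)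
antidiag-degree F (suc m) = begin
  fromℕ (suc m) ℚ.* (F 0 (suc m) ℚ.+ antidiag G m)
    ≡⟨ cong (ℚ._* (F 0 (suc m) ℚ.+ antidiag G m)) (fromℕ-suc m) ⟩
  (1ℚ ℚ.+ fromℕ m) ℚ.* (F 0 (suc m) ℚ.+ antidiag G m)
    ≡⟨ solve 3 (λ u x y → (con 1ℚ :+ u) :* (x :+ y) := (con 0ℚ :+ (con 1ℚ :+ u)) :* x :+ (y :+ u :* y))
         refl (fromℕ m) (F 0 (suc m)) (antidiag G m) ⟩
  (0ℚ ℚ.+ (1ℚ ℚ.+ fromℕ m)) ℚ.* F 0 (suc m) ℚ.+ (antidiag G m ℚ.+ fromℕ m ℚ.* antidiag G m)
    ≡⟨ cong₂ (λ p q → (0ℚ ℚ.+ p) ℚ.* F 0 (suc m) ℚ.+ (antidiag G m ℚ.+ q)) (sym (fromℕ-suc m)) (antidiag-degree G m) ⟩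
  (0ℚ ℚ.+ fromℕ (suc m)) ℚ.* F 0 (suc m) ℚ.+ (antidiag G m ℚ.+ antidiag (λ i j → (fromℕ i ℚ.+ fromℕ j) ℚ.* G i j) m)
    ≡⟨ cong ((0ℚ ℚ.+ fromℕ (suc m)) ℚ.* F 0 (suc m) ℚ.+_) (trans (sym (antidiag-+ G _ m)) (antidiag-cong m shift)) ⟩
  (0ℚ ℚ.+ fromℕ (suc m)) ℚ.* F 0 (suc m) ℚ.+ antidiag (λ i j → (fromℕ (suc i) ℚ.+ fromℕ j) ℚ.* G i j) m ∎
  where
  open ≡-Reasoning
  G = λ i j → F (suc i) j
  shift : ∀ i j → i ℕ.+ j ≡ m → G i j ℚ.+ (fromℕ i ℚ.+ fromℕ j) ℚ.* G i j ≡ (fromℕ (suc i) ℚ.+ fromℕ j) ℚ.* G i j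
  shift i j _ = trans (solve 3 (λ x u v → x :+ (u :+ v) :* x := ((con 1ℚ :+ u) :+ v) :* x) refl (G i j) (fromℕ i) (fromℕ j))
    (cong (λ p → (p ℚ.+ fromℕ j) ℚ.* G i j) (sym (fromℕ-suc i)))

antidiag-leibniz : ∀ (F : ℕ → ℕ → ℚ) n → fromℕ (suc n) ℚ.* antidiag F (suc n) ≡
  antidiag (λ j j′ → fromℕ (suc j) ℚ.* F (suc j) j′) n ℚ.+ antidiag (λ j j′ → fromℕ (suc j′) ℚ.* F j (suc j′)) n
antidiag-leibniz F n = begin
  fromℕ (suc n) ℚ.* antidiag F (suc n)                                  ≡⟨ antidiag-degree F (suc n) ⟩
  antidiag (λ i j → (fromℕ i ℚ.+ fromℕ j) ℚ.* F i j) (suc n)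
    ≡⟨ antidiag-cong (suc n) (λ i j _ → ℚP.*-distribʳ-+ (F i j) (fromℕ i) (fromℕ j)) ⟩
  antidiag (λ i j → fromℕ i ℚ.* F i j ℚ.+ fromℕ j ℚ.* F i j) (suc n)
    ≡⟨ antidiag-+ (λ i j → fromℕ i ℚ.* F i j) (λ i j → fromℕ j ℚ.* F i j) (suc n) ⟩
  antidiag (λ i j → fromℕ i ℚ.* F i j) (suc n) ℚ.+ antidiag (λ i j → fromℕ j ℚ.* F i j) (suc n)
    ≡⟨ cong (antidiag (λ i j → fromℕ i ℚ.* F i j) (suc n) ℚ.+_) (antidiag-snoc (λ i j → fromℕ j ℚ.* F i j) n) ⟩
  (0ℚ ℚ.* F 0 (suc n) ℚ.+ X) ℚ.+ (Y ℚ.+ 0ℚ ℚ.* F (suc n) 0)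
    ≡⟨ solve 4 (λ a x y b → (con 0ℚ :* a :+ x) :+ (y :+ con 0ℚ :* b) := x :+ y) refl (F 0 (suc n)) X Y (F (suc n) 0) ⟩
  X ℚ.+ Y                                                               ∎
  where
  open ≡-Reasoning
  X = antidiag (λ j j′ → fromℕ (suc j) ℚ.* F (suc j) j′) n
  Y = antidiag (λ j j′ → fromℕ (suc j′) ℚ.* F j (suc j′)) n

antidiag-head : ∀ (F : ℕ → ℕ → ℚ) m → (∀ i j → F (suc i) j ≡ 0ℚ) → antidiag F m ≡ F 0 m
antidiag-head F zero    _        = refl
antidiag-head F (suc m) F-vanish = begin
  F 0 (suc m) ℚ.+ antidiag (λ i → F (suc i)) m
    ≡⟨ cong (F 0 (suc m) ℚ.+_) (antidiag-head (λ i → F (suc i)) m (λ i → F-vanish (suc i))) ⟩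
  F 0 (suc m) ℚ.+ F 1 m                          ≡⟨ cong (F 0 (suc m) ℚ.+_) (F-vanish 0 m) ⟩
  F 0 (suc m) ℚ.+ 0ℚ                             ≡⟨ ℚP.+-identityʳ _ ⟩
  F 0 (suc m)                                    ∎
  where open ≡-Reasoning

isEven : ℕ → Bool
isEven zero    = true
isEven (suc n) = not (isEven n)

isEven-+-self : ∀ m → isEven (m ℕ.+ m) ≡ true
isEven-+-self zero    = refl
isEven-+-self (suc m) = begin
  not (isEven (m ℕ.+ suc m))        ≡⟨ cong (not ∘ isEven) (ℕP.+-suc m m) ⟩
  not (not (isEven (m ℕ.+ m)))      ≡⟨ not-involutive _ ⟩
  isEven (m ℕ.+ m)                  ≡⟨ isEven-+-self m ⟩
  true                              ∎
  where open ≡-Reasoning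

antidiag-even : ∀ (a b : ℕ → ℚ) → (∀ i → b (suc (i ℕ.+ i)) ≡ 0ℚ) → ∀ m →
  antidiag (λ i j → a i ℚ.* b j) (m ℕ.+ m) ≡ antidiag (λ i j → a (i ℕ.+ i) ℚ.* b (j ℕ.+ j)) m
antidiag-even a b b-odd≡0 zero    = refl
antidiag-even a b b-odd≡0 (suc m) = begin
  antidiag (λ i j → a i ℚ.* b j) (suc m ℕ.+ suc m)
    ≡⟨ cong (λ k → antidiag (λ i j → a i ℚ.* b j) (suc k)) (ℕP.+-suc m m) ⟩
  a 0 ℚ.* b (2+ (m ℕ.+ m)) ℚ.+ (a 1 ℚ.* b (suc (m ℕ.+ m)) ℚ.+ antidiag (λ i j → a (2+ i) ℚ.* b j) (m ℕ.+ m))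
    ≡⟨ cong₂ (λ p q → a 0 ℚ.* b (2+ (m ℕ.+ m)) ℚ.+ (a 1 ℚ.* p ℚ.+ q)) (b-odd≡0 m) (antidiag-even (a ∘ 2+_) b b-odd≡0 m) ⟩
  a 0 ℚ.* b (2+ (m ℕ.+ m)) ℚ.+ (a 1 ℚ.* 0ℚ ℚ.+ Rest)
    ≡⟨ cong (a 0 ℚ.* b (2+ (m ℕ.+ m)) ℚ.+_) (solve 2 (λ x y → x :* con 0ℚ :+ y := y) refl (a 1) Rest) ⟩
  a 0 ℚ.* b (2+ (m ℕ.+ m)) ℚ.+ Rest
    ≡⟨ cong₂ (λ k r → a 0 ℚ.* b (suc k) ℚ.+ r) (ℕP.+-suc m m)
         (antidiag-cong m (λ i j _ → cong (λ k → a (suc k) ℚ.* b (j ℕ.+ j)) (ℕP.+-suc i i))) ⟨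
  antidiag (λ i j → a (i ℕ.+ i) ℚ.* b (j ℕ.+ j)) (suc m) ∎
  where
  open ≡-Reasoning
  2+_ : ℕ → ℕ
  2+ k = suc (suc k)
  Rest = antidiag (λ i j → a (2+ (i ℕ.+ i)) ℚ.* b (j ℕ.+ j)) m

TangentRecurrence : (ℕ → ℚ) → Set
TangentRecurrence a = ∀ m → fromℕ (suc (suc m ℕ.+ suc m)) ℚ.* a (suc m) ≡ antidiag (λ i j → a i ℚ.* a j) m

TangentRecurrence-unique : ∀ {a b} → a 0 ≡ b 0 → TangentRecurrence a → TangentRecurrence b → ∀ n → a n ≡ b n
TangentRecurrence-unique {a} {b} a₀≡b₀ recᵃ recᵇ n = agree n n ℕP.≤-refl
  where
  agree : ∀ n k → k ≤ n → a k ≡ b k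
  agree n       zero    _         = a₀≡b₀
  agree (suc n) (suc m) (s≤s m≤n) = *-cancelˡ-fromℕ (suc (suc m ℕ.+ suc m)) (begin
    fromℕ (suc (suc m ℕ.+ suc m)) ℚ.* a (suc m)  ≡⟨ recᵃ m ⟩
    antidiag (λ i j → a i ℚ.* a j) m              ≡⟨ antidiag-cong m agreeOnAntidiagonal ⟩
    antidiag (λ i j → b i ℚ.* b j) m              ≡⟨ recᵇ m ⟨
    fromℕ (suc (suc m ℕ.+ suc m)) ℚ.* b (suc m)  ∎)
    where
    open ≡-Reasoning
    agreeOnAntidiagonal : ∀ i j → i ℕ.+ j ≡ m → a i ℚ.* a j ≡ b i ℚ.* b j
    agreeOnAntidiagonal i j i+j≡m = cong₂ ℚ._*_
      (agree n i (ℕP.≤-trans (ℕP.m≤m+n i j) (ℕP.≤-trans (ℕP.≤-reflexive i+j≡m) m≤n)))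
      (agree n j (ℕP.≤-trans (ℕP.m≤n+m j i) (ℕP.≤-trans (ℕP.≤-reflexive i+j≡m) m≤n)))

sumℚ-++ : (xs ys : List ℚ) → sumℚ (xs ++ ys) ≡ sumℚ xs ℚ.+ sumℚ ys
sumℚ-++ []       ys = sym (ℚP.+-identityˡ _)
sumℚ-++ (x ∷ xs) ys = trans (cong (x ℚ.+_) (sumℚ-++ xs ys)) (sym (ℚP.+-assoc x _ _))

sumℚ-cong : ∀ {A : Set} {f g : A → ℚ} xs → (∀ x → f x ≡ g x) → sumℚ (map f xs) ≡ sumℚ (map g xs)
sumℚ-cong xs eq = cong sumℚ (LP.map-cong eq xs)

sumℚ-*ˡ : ∀ {A : Set} (c : ℚ) (f : A → ℚ) xs → sumℚ (map (λ x → c ℚ.* f x) xs) ≡ c ℚ.* sumℚ (map f xs)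
sumℚ-*ˡ c f []       = sym (ℚP.*-zeroʳ c)
sumℚ-*ˡ c f (x ∷ xs) = trans (cong (c ℚ.* f x ℚ.+_) (sumℚ-*ˡ c f xs)) (sym (ℚP.*-distribˡ-+ c _ _))

sumℚ-concatMap : ∀ {A B : Set} (f : B → ℚ) (g : A → List B) xs →
                 sumℚ (map f (concatMap g xs)) ≡ sumℚ (map (λ x → sumℚ (map f (g x))) xs)
sumℚ-concatMap f g []       = refl
sumℚ-concatMap f g (x ∷ xs) = begin
  sumℚ (map f (g x ++ concatMap g xs))            ≡⟨ cong sumℚ (LP.map-++ f (g x) _) ⟩
  sumℚ (map f (g x) ++ map f (concatMap g xs))    ≡⟨ sumℚ-++ (map f (g x)) _ ⟩
  _                                               ≡⟨ cong (sumℚ (map f (g x)) ℚ.+_) (sumℚ-concatMap f g xs) ⟩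
  _                                               ∎
  where open ≡-Reasoning

indicator : ∀ {P : Set} → Dec P → ℚ → ℚ
indicator P? q = if does P? then q else 0ℚ

sumℚ-filter : ∀ {A : Set} {P : Pred A _} (P? : Decidable P) (f : A → ℚ) xs →
              sumℚ (map f (filter P? xs)) ≡ sumℚ (map (λ x → indicator (P? x) (f x)) xs)
sumℚ-filter P? f []       = refl
sumℚ-filter P? f (x ∷ xs) with does (P? x)
... | true  = cong (f x ℚ.+_) (sumℚ-filter P? f xs)
... | false = trans (sumℚ-filter P? f xs) (sym (ℚP.+-identityˡ _))

indicator-*ˡ : ∀ {P : Set} (P? : Dec P) c q → indicator P? (c ℚ.* q) ≡ c ℚ.* indicator P? q
indicator-*ˡ P? c q with does P?
... | true  = refl
... | false = sym (ℚP.*-zeroʳ c)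

weightAt : ℕ → ℚ
weightAt b = + 1 / suc (2 ℕ.* b)

pathWeight : ℤ → List Bool → ℚ
pathWeight z s = prodℚ (map (λ b → weightAt ∣ b ∣) (heights z s))

nonnegFrom? : (z : ℤ) (s : List Bool) → Dec (All (+ 0 ℤ.≤_) (heights z s) × endHeight z s ≡ + 0)
nonnegFrom? z s = all? (+ 0 ℤ.≤?_) (heights z s) ×-dec (endHeight z s ℤ.≟ + 0)

nonnegWeight : ℤ → List Bool → ℚ
nonnegWeight z s = indicator (nonnegFrom? z s) (pathWeight z s)

heightFactor : ℤ → ℚ
heightFactor z = if does (+ 0 ℤ.≤? z) then weightAt ∣ z ∣ else 0ℚ

nonnegWeight-∷ : ∀ z u s → nonnegWeight z (u ∷ s) ≡ heightFactor z ℚ.* nonnegWeight (z ℤ.+ step u) s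
nonnegWeight-∷ z u s with does (+ 0 ℤ.≤? z)
... | true  = indicator-*ˡ (nonnegFrom? (z ℤ.+ step u) s) (weightAt ∣ z ∣) (pathWeight (z ℤ.+ step u) s)
... | false = sym (ℚP.*-zeroˡ (nonnegWeight (z ℤ.+ step u) s))

pathSumℤ : ℤ → ℕ → ℚ
pathSumℤ z L = sumℚ (map (nonnegWeight z) (words (true ∷ false ∷ []) L))

pathSumℤ-suc : ∀ z L → pathSumℤ z (suc L) ≡
  heightFactor z ℚ.* pathSumℤ (z ℤ.+ + 1) L ℚ.+ (heightFactor z ℚ.* pathSumℤ (z ℤ.+ -[1+ 0 ]) L ℚ.+ 0ℚ)
pathSumℤ-suc z L =
  trans (sumℚ-concatMap (nonnegWeight z) (λ u → map (u ∷_) (words (true ∷ false ∷ []) L)) (true ∷ false ∷ []))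
    (sumℚ-cong (true ∷ false ∷ []) firstStep)
  where
  firstStep : ∀ u → sumℚ (map (nonnegWeight z) (map (u ∷_) (words (true ∷ false ∷ []) L))) ≡
                    heightFactor z ℚ.* pathSumℤ (z ℤ.+ step u) L
  firstStep u = begin
    sumℚ (map (nonnegWeight z) (map (u ∷_) ws))                        ≡⟨ cong sumℚ (sym (LP.map-∘ ws)) ⟩
    sumℚ (map (λ s → nonnegWeight z (u ∷ s)) ws)                       ≡⟨ sumℚ-cong ws (nonnegWeight-∷ z u) ⟩
    sumℚ (map (λ s → heightFactor z ℚ.* nonnegWeight (z ℤ.+ step u) s) ws)
      ≡⟨ sumℚ-*ˡ (heightFactor z) (nonnegWeight (z ℤ.+ step u)) ws ⟩
    heightFactor z ℚ.* pathSumℤ (z ℤ.+ step u) L                        ∎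
    where open ≡-Reasoning
          ws = words (true ∷ false ∷ []) L

pathSumℤ-neg : ∀ k L → pathSumℤ -[1+ k ] L ≡ 0ℚ
pathSumℤ-neg k zero    = refl
pathSumℤ-neg k (suc L) = trans (pathSumℤ-suc -[1+ k ] L)
  (solve 2 (λ x y → con 0ℚ :* x :+ (con 0ℚ :* y :+ con 0ℚ) := con 0ℚ) refl (pathSumℤ _ L) (pathSumℤ _ L))

-- pathSum h L is W_h(L); pathSumPred h L is W_(h-1)(L), which vanishes for h = 0.
mutual
  pathSum : ℕ → ℕ → ℚ
  pathSum h       (suc L) = weightAt h ℚ.* (pathSum (suc h) L ℚ.+ pathSumPred h L)
  pathSum zero    zero    = 1ℚ
  pathSum (suc h) zero    = 0ℚ

  pathSumPred : ℕ → ℕ → ℚ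
  pathSumPred zero    L = 0ℚ
  pathSumPred (suc h) L = pathSum h L

pathSumℤ≡pathSum : ∀ L h → pathSumℤ (+ h) L ≡ pathSum h L
pathSumℤ≡pathSum zero    zero    = refl
pathSumℤ≡pathSum zero    (suc h) = refl
pathSumℤ≡pathSum (suc L) h       = begin
  pathSumℤ (+ h) (suc L)                                            ≡⟨ pathSumℤ-suc (+ h) L ⟩
  weightAt h ℚ.* pathSumℤ (+ h ℤ.+ + 1) L ℚ.+ (weightAt h ℚ.* pathSumℤ (+ h ℤ.+ -[1+ 0 ]) L ℚ.+ 0ℚ)
    ≡⟨ cong₂ (λ a b → weightAt h ℚ.* a ℚ.+ (weightAt h ℚ.* b ℚ.+ 0ℚ)) up (down h) ⟩
  weightAt h ℚ.* pathSum (suc h) L ℚ.+ (weightAt h ℚ.* pathSumPred h L ℚ.+ 0ℚ)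
    ≡⟨ solve 3 (λ x y z → x :* y :+ (x :* z :+ con 0ℚ) := x :* (y :+ z)) refl
         (weightAt h) (pathSum (suc h) L) (pathSumPred h L) ⟩
  pathSum h (suc L)                                                  ∎
  where
  open ≡-Reasoning
  up : pathSumℤ (+ h ℤ.+ + 1) L ≡ pathSum (suc h) L
  up = trans (cong (λ z → pathSumℤ z L) (trans (ℤP.pos-+ h 1) (cong +_ (ℕP.+-comm h 1))))
    (pathSumℤ≡pathSum L (suc h))
  down : ∀ h → pathSumℤ (+ h ℤ.+ -[1+ 0 ]) L ≡ pathSumPred h L
  down zero    = pathSumℤ-neg 0 L
  down (suc k) = pathSumℤ≡pathSum L k

sum-weight-Dyck : ∀ n → sumℚ (map weight (Dyck n)) ≡ pathSum 0 (2 ℕ.* n)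
sum-weight-Dyck n = trans (sumℚ-filter (nonnegFrom? (+ 0)) weight (words (true ∷ false ∷ []) (2 ℕ.* n)))
  (pathSumℤ≡pathSum (2 ℕ.* n) 0)

odd : ℕ → ℚ
odd h = fromℕ (suc (2 ℕ.* h))

odd≡1+h+h : ∀ h → odd h ≡ 1ℚ ℚ.+ (fromℕ h ℚ.+ fromℕ h)
odd≡1+h+h h = trans (fromℕ-suc (2 ℕ.* h))
  (cong (1ℚ ℚ.+_) (trans (cong fromℕ (cong (h ℕ.+_) (ℕP.+-identityʳ h))) (fromℕ-+ h h)))

odd-suc : ∀ h → odd (suc h) ≡ 1ℚ ℚ.+ ((1ℚ ℚ.+ fromℕ h) ℚ.+ (1ℚ ℚ.+ fromℕ h))
odd-suc h = trans (odd≡1+h+h (suc h)) (cong (λ u → 1ℚ ℚ.+ (u ℚ.+ u)) (fromℕ-suc h))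

odd-*-pathSum-suc : ∀ h L → odd h ℚ.* pathSum h (suc L) ≡ pathSum (suc h) L ℚ.+ pathSumPred h L
odd-*-pathSum-suc h L = begin
  odd h ℚ.* (weightAt h ℚ.* X)   ≡⟨ ℚP.*-assoc (odd h) (weightAt h) X ⟨
  odd h ℚ.* weightAt h ℚ.* X     ≡⟨ cong (ℚ._* X) (trans (ℚP.*-comm (odd h) (weightAt h)) (i/n*n≡i (+ 1) (suc (2 ℕ.* h)))) ⟩
  1ℚ ℚ.* X                       ≡⟨ ℚP.*-identityˡ X ⟩
  X                              ∎
  where
  open ≡-Reasoning
  X = pathSum (suc h) L ℚ.+ pathSumPred h L

pathSum-0-suc : ∀ L → pathSum 0 (suc L) ≡ pathSum 1 L
pathSum-0-suc L = solve 1 (λ x → con 1ℚ :* (x :+ con 0ℚ) := x) refl (pathSum 1 L)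

conv : ℕ → ℕ → ℚ
conv h zero    = 0ℚ
conv h (suc L) = antidiag (λ i j → pathSum 0 i ℚ.* pathSum h j) L

conv-step₀ : ∀ L → pathSum 0 L ℚ.+ conv 1 L ≡ conv 0 (suc L)
conv-step₀ zero    = refl
conv-step₀ (suc L) = begin
  pathSum 0 (suc L) ℚ.+ antidiag (λ i j → pathSum 0 i ℚ.* pathSum 1 j) L
    ≡⟨ ℚP.+-comm (pathSum 0 (suc L)) _ ⟩
  antidiag (λ i j → pathSum 0 i ℚ.* pathSum 1 j) L ℚ.+ pathSum 0 (suc L)
    ≡⟨ cong₂ ℚ._+_ (antidiag-cong L (λ i j _ → cong (pathSum 0 i ℚ.*_) (pathSum-0-suc j)))
                   (ℚP.*-identityʳ (pathSum 0 (suc L))) ⟨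
  antidiag (λ i j → pathSum 0 i ℚ.* pathSum 0 (suc j)) L ℚ.+ pathSum 0 (suc L) ℚ.* pathSum 0 0
    ≡⟨ antidiag-snoc (λ i j → pathSum 0 i ℚ.* pathSum 0 j) L ⟨
  conv 0 (suc (suc L)) ∎
  where open ≡-Reasoning

conv-step : ∀ h L → conv (suc (suc h)) L ℚ.+ conv h L ≡ odd (suc h) ℚ.* conv (suc h) (suc L)
conv-step h zero    = solve 1 (λ x → con 0ℚ :+ con 0ℚ := x :* (con 1ℚ :* con 0ℚ)) refl (odd (suc h))
conv-step h (suc L) = begin
  antidiag (λ i j → pathSum 0 i ℚ.* pathSum (suc (suc h)) j) L ℚ.+ antidiag (λ i j → pathSum 0 i ℚ.* pathSum h j) L
    ≡⟨ antidiag-+ (λ i j → pathSum 0 i ℚ.* pathSum (suc (suc h)) j) (λ i j → pathSum 0 i ℚ.* pathSum h j) L ⟨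
  antidiag (λ i j → pathSum 0 i ℚ.* pathSum (suc (suc h)) j ℚ.+ pathSum 0 i ℚ.* pathSum h j) L
    ≡⟨ antidiag-cong L (λ i j _ → pathSum-step i j) ⟩
  antidiag (λ i j → odd (suc h) ℚ.* (pathSum 0 i ℚ.* pathSum (suc h) (suc j))) L
    ≡⟨ antidiag-*ˡ (odd (suc h)) (λ i j → pathSum 0 i ℚ.* pathSum (suc h) (suc j)) L ⟩
  odd (suc h) ℚ.* antidiag (λ i j → pathSum 0 i ℚ.* pathSum (suc h) (suc j)) L
    ≡⟨ solve 3 (λ a b c → a :* b := a :* (b :+ c :* con 0ℚ)) refl (odd (suc h)) _ (pathSum 0 (suc L)) ⟩
  odd (suc h) ℚ.* (antidiag (λ i j → pathSum 0 i ℚ.* pathSum (suc h) (suc j)) L ℚ.+ pathSum 0 (suc L) ℚ.* pathSum (suc h) 0)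
    ≡⟨ cong (odd (suc h) ℚ.*_) (antidiag-snoc (λ i j → pathSum 0 i ℚ.* pathSum (suc h) j) L) ⟨
  odd (suc h) ℚ.* conv (suc h) (suc (suc L)) ∎
  where
  open ≡-Reasoning
  pathSum-step : ∀ i j → pathSum 0 i ℚ.* pathSum (suc (suc h)) j ℚ.+ pathSum 0 i ℚ.* pathSum h j ≡
                         odd (suc h) ℚ.* (pathSum 0 i ℚ.* pathSum (suc h) (suc j))
  pathSum-step i j = begin
    pathSum 0 i ℚ.* pathSum (suc (suc h)) j ℚ.+ pathSum 0 i ℚ.* pathSum h j  ≡⟨ ℚP.*-distribˡ-+ (pathSum 0 i) _ _ ⟨
    pathSum 0 i ℚ.* (pathSum (suc (suc h)) j ℚ.+ pathSum h j)             ≡⟨ cong (pathSum 0 i ℚ.*_) (odd-*-pathSum-suc (suc h) j) ⟨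
    pathSum 0 i ℚ.* (odd (suc h) ℚ.* pathSum (suc h) (suc j))
      ≡⟨ solve 3 (λ a b c → a :* (b :* c) := b :* (a :* c)) refl (pathSum 0 i) (odd (suc h)) (pathSum (suc h) (suc j)) ⟩
    odd (suc h) ℚ.* (pathSum 0 i ℚ.* pathSum (suc h) (suc j))             ∎

-- At h = 0 this is the recurrence for W_0; the other heights are needed to carry the induction on L.
PathSumIdentity : ℕ → ℕ → Set
PathSumIdentity L h = odd h ℚ.* (1ℚ ℚ.+ fromℕ L) ℚ.* pathSum h (suc L) ≡
  fromℕ h ℚ.* pathSumPred h L ℚ.- (1ℚ ℚ.+ fromℕ h) ℚ.* pathSum (suc h) L ℚ.+ odd h ℚ.* conv h L

pathSumIdentity-zero : ∀ h → PathSumIdentity 0 h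
pathSumIdentity-zero zero          = refl
pathSumIdentity-zero (suc zero)    = refl
pathSumIdentity-zero (suc (suc h)) = begin
  odd h′ ℚ.* (1ℚ ℚ.+ fromℕ 0) ℚ.* pathSum h′ 1
    ≡⟨ solve 3 (λ a b w → a :* b :* w := b :* (a :* w)) refl (odd h′) (1ℚ ℚ.+ fromℕ 0) (pathSum h′ 1) ⟩
  (1ℚ ℚ.+ fromℕ 0) ℚ.* (odd h′ ℚ.* pathSum h′ 1)
    ≡⟨ cong ((1ℚ ℚ.+ fromℕ 0) ℚ.*_) (odd-*-pathSum-suc h′ 0) ⟩
  (1ℚ ℚ.+ fromℕ 0) ℚ.* (0ℚ ℚ.+ 0ℚ)
    ≡⟨ solve 2 (λ a b → (con 1ℚ :+ con 0ℚ) :* (con 0ℚ :+ con 0ℚ) := a :* con 0ℚ :- (con 1ℚ :+ a) :* con 0ℚ :+ b :* con 0ℚ)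
         refl (fromℕ h′) (odd h′) ⟩
  fromℕ h′ ℚ.* 0ℚ ℚ.- (1ℚ ℚ.+ fromℕ h′) ℚ.* 0ℚ ℚ.+ odd h′ ℚ.* 0ℚ ∎
  where
  open ≡-Reasoning
  h′ = suc (suc h)

module PathSumIdentityStep (L : ℕ) (identity : ∀ h → PathSumIdentity L h) where
  open ≡-Reasoning

  upper : ∀ h → (1ℚ ℚ.+ fromℕ L) ℚ.* pathSum (suc h) (suc L) ℚ.+ (1ℚ ℚ.+ (1ℚ ℚ.+ fromℕ h)) ℚ.* pathSum (suc h) (suc L)
                ≡ pathSum h L ℚ.+ conv (suc h) L
  upper h = *-cancelˡ-fromℕ (suc (2 ℕ.* suc h)) (begin
    odd (suc h) ℚ.* ((1ℚ ℚ.+ fromℕ L) ℚ.* A ℚ.+ (1ℚ ℚ.+ (1ℚ ℚ.+ fromℕ h)) ℚ.* A)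
      ≡⟨ solve 4 (λ K x u a → K :* ((con 1ℚ :+ x) :* a :+ (con 1ℚ :+ (con 1ℚ :+ u)) :* a)
                  := K :* (con 1ℚ :+ x) :* a :+ (con 1ℚ :+ (con 1ℚ :+ u)) :* (K :* a)) refl (odd (suc h)) (fromℕ L) (fromℕ h) A ⟩
    odd (suc h) ℚ.* (1ℚ ℚ.+ fromℕ L) ℚ.* A ℚ.+ (1ℚ ℚ.+ (1ℚ ℚ.+ fromℕ h)) ℚ.* (odd (suc h) ℚ.* A)
      ≡⟨ cong₂ (λ p q → p ℚ.+ (1ℚ ℚ.+ (1ℚ ℚ.+ fromℕ h)) ℚ.* q) (identity (suc h)) (odd-*-pathSum-suc (suc h) L) ⟩
    (fromℕ (suc h) ℚ.* B ℚ.- (1ℚ ℚ.+ fromℕ (suc h)) ℚ.* C ℚ.+ odd (suc h) ℚ.* D) ℚ.+ (1ℚ ℚ.+ (1ℚ ℚ.+ fromℕ h)) ℚ.* (C ℚ.+ B)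
      ≡⟨ cong₂ (λ p q → (p ℚ.* B ℚ.- (1ℚ ℚ.+ p) ℚ.* C ℚ.+ q ℚ.* D) ℚ.+ (1ℚ ℚ.+ (1ℚ ℚ.+ fromℕ h)) ℚ.* (C ℚ.+ B))
           (fromℕ-suc h) (odd-suc h) ⟩
    ((1ℚ ℚ.+ fromℕ h) ℚ.* B ℚ.- (1ℚ ℚ.+ (1ℚ ℚ.+ fromℕ h)) ℚ.* C ℚ.+ K ℚ.* D) ℚ.+ (1ℚ ℚ.+ (1ℚ ℚ.+ fromℕ h)) ℚ.* (C ℚ.+ B)
      ≡⟨ solve 4 (λ u b c d → ((con 1ℚ :+ u) :* b :- (con 1ℚ :+ (con 1ℚ :+ u)) :* c :+ (con 1ℚ :+ ((con 1ℚ :+ u) :+ (con 1ℚ :+ u))) :* d)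
                                :+ (con 1ℚ :+ (con 1ℚ :+ u)) :* (c :+ b)
                  := (con 1ℚ :+ ((con 1ℚ :+ u) :+ (con 1ℚ :+ u))) :* (b :+ d)) refl (fromℕ h) B C D ⟩
    K ℚ.* (B ℚ.+ D)             ≡⟨ cong (ℚ._* (B ℚ.+ D)) (odd-suc h) ⟨
    odd (suc h) ℚ.* (B ℚ.+ D)   ∎)
    where
    A = pathSum (suc h) (suc L)
    B = pathSum h L
    C = pathSum (suc (suc h)) L
    D = conv (suc h) L
    K = 1ℚ ℚ.+ ((1ℚ ℚ.+ fromℕ h) ℚ.+ (1ℚ ℚ.+ fromℕ h))

  lower : ∀ h → (1ℚ ℚ.+ fromℕ L) ℚ.* pathSum h (suc L) ℚ.- fromℕ h ℚ.* pathSum h (suc L) ≡ ℚ.- pathSum (suc h) L ℚ.+ conv h L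
  lower h = *-cancelˡ-fromℕ (suc (2 ℕ.* h)) (begin
    odd h ℚ.* ((1ℚ ℚ.+ fromℕ L) ℚ.* A ℚ.- fromℕ h ℚ.* A)
      ≡⟨ solve 4 (λ K x u a → K :* ((con 1ℚ :+ x) :* a :- u :* a) := K :* (con 1ℚ :+ x) :* a :- u :* (K :* a))
           refl (odd h) (fromℕ L) (fromℕ h) A ⟩
    odd h ℚ.* (1ℚ ℚ.+ fromℕ L) ℚ.* A ℚ.- fromℕ h ℚ.* (odd h ℚ.* A)
      ≡⟨ cong₂ (λ p q → p ℚ.- fromℕ h ℚ.* q) (identity h) (odd-*-pathSum-suc h L) ⟩
    (fromℕ h ℚ.* B ℚ.- (1ℚ ℚ.+ fromℕ h) ℚ.* C ℚ.+ odd h ℚ.* D) ℚ.- fromℕ h ℚ.* (C ℚ.+ B)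
      ≡⟨ cong (λ k → (fromℕ h ℚ.* B ℚ.- (1ℚ ℚ.+ fromℕ h) ℚ.* C ℚ.+ k ℚ.* D) ℚ.- fromℕ h ℚ.* (C ℚ.+ B)) (odd≡1+h+h h) ⟩
    (fromℕ h ℚ.* B ℚ.- (1ℚ ℚ.+ fromℕ h) ℚ.* C ℚ.+ (1ℚ ℚ.+ (fromℕ h ℚ.+ fromℕ h)) ℚ.* D) ℚ.- fromℕ h ℚ.* (C ℚ.+ B)
      ≡⟨ solve 4 (λ u b c d → (u :* b :- (con 1ℚ :+ u) :* c :+ (con 1ℚ :+ (u :+ u)) :* d) :- u :* (c :+ b)
                   := (con 1ℚ :+ (u :+ u)) :* (:- c :+ d)) refl (fromℕ h) B C D ⟩
    (1ℚ ℚ.+ (fromℕ h ℚ.+ fromℕ h)) ℚ.* (ℚ.- C ℚ.+ D)   ≡⟨ cong (ℚ._* (ℚ.- C ℚ.+ D)) (odd≡1+h+h h) ⟨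
    odd h ℚ.* (ℚ.- C ℚ.+ D)                             ∎)
    where
    A = pathSum h (suc L)
    B = pathSumPred h L
    C = pathSum (suc h) L
    D = conv h L

  identity-suc : ∀ h → PathSumIdentity (suc L) h
  identity-suc zero = begin
    odd 0 ℚ.* (1ℚ ℚ.+ fromℕ (suc L)) ℚ.* pathSum 0 (suc (suc L))
      ≡⟨ cong (λ v → odd 0 ℚ.* (1ℚ ℚ.+ v) ℚ.* pathSum 0 (suc (suc L))) (fromℕ-suc L) ⟩
    odd 0 ℚ.* (1ℚ ℚ.+ (1ℚ ℚ.+ fromℕ L)) ℚ.* pathSum 0 (suc (suc L))
      ≡⟨ solve 3 (λ K x w → K :* (con 1ℚ :+ (con 1ℚ :+ x)) :* w := (con 1ℚ :+ (con 1ℚ :+ x)) :* (K :* w))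
           refl (odd 0) (fromℕ L) (pathSum 0 (suc (suc L))) ⟩
    (1ℚ ℚ.+ (1ℚ ℚ.+ fromℕ L)) ℚ.* (odd 0 ℚ.* pathSum 0 (suc (suc L)))
      ≡⟨ cong ((1ℚ ℚ.+ (1ℚ ℚ.+ fromℕ L)) ℚ.*_) (odd-*-pathSum-suc 0 (suc L)) ⟩
    (1ℚ ℚ.+ (1ℚ ℚ.+ fromℕ L)) ℚ.* (A ℚ.+ 0ℚ)
      ≡⟨ solve 3 (λ x u a → (con 1ℚ :+ (con 1ℚ :+ x)) :* (a :+ con 0ℚ)
                          := ((con 1ℚ :+ x) :* a :+ (con 1ℚ :+ (con 1ℚ :+ u)) :* a) :- (con 1ℚ :+ u) :* a)
           refl (fromℕ L) (fromℕ 0) A ⟩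
    ((1ℚ ℚ.+ fromℕ L) ℚ.* A ℚ.+ (1ℚ ℚ.+ (1ℚ ℚ.+ fromℕ 0)) ℚ.* A) ℚ.- (1ℚ ℚ.+ fromℕ 0) ℚ.* A
      ≡⟨ cong (ℚ._- (1ℚ ℚ.+ fromℕ 0) ℚ.* A) (trans (upper 0) (conv-step₀ L)) ⟩
    conv 0 (suc L) ℚ.- (1ℚ ℚ.+ fromℕ 0) ℚ.* A
      ≡⟨ solve 3 (λ c u a → c :- (con 1ℚ :+ u) :* a := u :* con 0ℚ :- (con 1ℚ :+ u) :* a :+ con 1ℚ :* c)
           refl (conv 0 (suc L)) (fromℕ 0) A ⟩
    fromℕ 0 ℚ.* 0ℚ ℚ.- (1ℚ ℚ.+ fromℕ 0) ℚ.* A ℚ.+ 1ℚ ℚ.* conv 0 (suc L) ∎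
    where A = pathSum 1 (suc L)
  identity-suc (suc h) = begin
    odd (suc h) ℚ.* (1ℚ ℚ.+ fromℕ (suc L)) ℚ.* pathSum (suc h) (suc (suc L))
      ≡⟨ cong (λ v → odd (suc h) ℚ.* (1ℚ ℚ.+ v) ℚ.* pathSum (suc h) (suc (suc L))) (fromℕ-suc L) ⟩
    odd (suc h) ℚ.* (1ℚ ℚ.+ (1ℚ ℚ.+ fromℕ L)) ℚ.* pathSum (suc h) (suc (suc L))
      ≡⟨ solve 3 (λ K x w → K :* (con 1ℚ :+ (con 1ℚ :+ x)) :* w := (con 1ℚ :+ (con 1ℚ :+ x)) :* (K :* w))
           refl (odd (suc h)) (fromℕ L) (pathSum (suc h) (suc (suc L))) ⟩
    (1ℚ ℚ.+ (1ℚ ℚ.+ fromℕ L)) ℚ.* (odd (suc h) ℚ.* pathSum (suc h) (suc (suc L)))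
      ≡⟨ cong ((1ℚ ℚ.+ (1ℚ ℚ.+ fromℕ L)) ℚ.*_) (odd-*-pathSum-suc (suc h) (suc L)) ⟩
    (1ℚ ℚ.+ (1ℚ ℚ.+ fromℕ L)) ℚ.* (A ℚ.+ B)
      ≡⟨ solve 4 (λ x u a b → (con 1ℚ :+ (con 1ℚ :+ x)) :* (a :+ b)
            := (((con 1ℚ :+ x) :* a :+ (con 1ℚ :+ (con 1ℚ :+ (con 1ℚ :+ u))) :* a) :+ ((con 1ℚ :+ x) :* b :- u :* b))
               :- (con 1ℚ :+ (con 1ℚ :+ u)) :* a :+ (con 1ℚ :+ u) :* b) refl (fromℕ L) (fromℕ h) A B ⟩
    (((1ℚ ℚ.+ fromℕ L) ℚ.* A ℚ.+ (1ℚ ℚ.+ (1ℚ ℚ.+ (1ℚ ℚ.+ fromℕ h))) ℚ.* A) ℚ.+ ((1ℚ ℚ.+ fromℕ L) ℚ.* B ℚ.- fromℕ h ℚ.* B))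
      ℚ.- (1ℚ ℚ.+ (1ℚ ℚ.+ fromℕ h)) ℚ.* A ℚ.+ (1ℚ ℚ.+ fromℕ h) ℚ.* B
      ≡⟨ cong₂ (λ p q → (p ℚ.+ q) ℚ.- (1ℚ ℚ.+ (1ℚ ℚ.+ fromℕ h)) ℚ.* A ℚ.+ (1ℚ ℚ.+ fromℕ h) ℚ.* B) upper′ (lower h) ⟩
    ((pathSum (suc h) L ℚ.+ conv (suc (suc h)) L) ℚ.+ (ℚ.- pathSum (suc h) L ℚ.+ conv h L))
      ℚ.- (1ℚ ℚ.+ (1ℚ ℚ.+ fromℕ h)) ℚ.* A ℚ.+ (1ℚ ℚ.+ fromℕ h) ℚ.* B
      ≡⟨ solve 6 (λ w c₂ c₀ u a b → ((w :+ c₂) :+ (:- w :+ c₀)) :- (con 1ℚ :+ (con 1ℚ :+ u)) :* a :+ (con 1ℚ :+ u) :* b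
                    := (c₂ :+ c₀) :- (con 1ℚ :+ (con 1ℚ :+ u)) :* a :+ (con 1ℚ :+ u) :* b)
           refl (pathSum (suc h) L) (conv (suc (suc h)) L) (conv h L) (fromℕ h) A B ⟩
    (conv (suc (suc h)) L ℚ.+ conv h L) ℚ.- (1ℚ ℚ.+ (1ℚ ℚ.+ fromℕ h)) ℚ.* A ℚ.+ (1ℚ ℚ.+ fromℕ h) ℚ.* B
      ≡⟨ cong (λ p → p ℚ.- (1ℚ ℚ.+ (1ℚ ℚ.+ fromℕ h)) ℚ.* A ℚ.+ (1ℚ ℚ.+ fromℕ h) ℚ.* B) (conv-step h L) ⟩
    D ℚ.- (1ℚ ℚ.+ (1ℚ ℚ.+ fromℕ h)) ℚ.* A ℚ.+ (1ℚ ℚ.+ fromℕ h) ℚ.* B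
      ≡⟨ solve 4 (λ d u a b → d :- (con 1ℚ :+ (con 1ℚ :+ u)) :* a :+ (con 1ℚ :+ u) :* b
                    := (con 1ℚ :+ u) :* b :- (con 1ℚ :+ (con 1ℚ :+ u)) :* a :+ d) refl D (fromℕ h) A B ⟩
    (1ℚ ℚ.+ fromℕ h) ℚ.* B ℚ.- (1ℚ ℚ.+ (1ℚ ℚ.+ fromℕ h)) ℚ.* A ℚ.+ D
      ≡⟨ cong (λ v → v ℚ.* B ℚ.- (1ℚ ℚ.+ v) ℚ.* A ℚ.+ D) (fromℕ-suc h) ⟨
    fromℕ (suc h) ℚ.* B ℚ.- (1ℚ ℚ.+ fromℕ (suc h)) ℚ.* A ℚ.+ D ∎
    where
    A = pathSum (suc (suc h)) (suc L)
    B = pathSum h (suc L)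
    D = odd (suc h) ℚ.* conv (suc h) (suc L)
    upper′ : (1ℚ ℚ.+ fromℕ L) ℚ.* A ℚ.+ (1ℚ ℚ.+ (1ℚ ℚ.+ (1ℚ ℚ.+ fromℕ h))) ℚ.* A ≡ pathSum (suc h) L ℚ.+ conv (suc (suc h)) L
    upper′ = trans (cong (λ v → (1ℚ ℚ.+ fromℕ L) ℚ.* A ℚ.+ (1ℚ ℚ.+ (1ℚ ℚ.+ v)) ℚ.* A) (sym (fromℕ-suc h))) (upper (suc h))

pathSum-identity : ∀ L h → PathSumIdentity L h
pathSum-identity zero    = pathSumIdentity-zero
pathSum-identity (suc L) = PathSumIdentityStep.identity-suc L (pathSum-identity L)

pathSum-0-recurrence : ∀ L → fromℕ (suc (suc L)) ℚ.* pathSum 0 (suc L) ≡ conv 0 L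
pathSum-0-recurrence L = begin
  fromℕ (suc (suc L)) ℚ.* W
    ≡⟨ cong (ℚ._* W) (trans (fromℕ-suc (suc L)) (cong (1ℚ ℚ.+_) (fromℕ-suc L))) ⟩
  (1ℚ ℚ.+ (1ℚ ℚ.+ fromℕ L)) ℚ.* W
    ≡⟨ solve 2 (λ x w → (con 1ℚ :+ (con 1ℚ :+ x)) :* w := con 1ℚ :* (con 1ℚ :+ x) :* w :+ (con 1ℚ :+ con 0ℚ) :* w)
         refl (fromℕ L) W ⟩
  odd 0 ℚ.* (1ℚ ℚ.+ fromℕ L) ℚ.* W ℚ.+ (1ℚ ℚ.+ fromℕ 0) ℚ.* W
    ≡⟨ cong₂ (λ p q → p ℚ.+ (1ℚ ℚ.+ fromℕ 0) ℚ.* q) (pathSum-identity L 0) (pathSum-0-suc L) ⟩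
  (fromℕ 0 ℚ.* 0ℚ ℚ.- (1ℚ ℚ.+ fromℕ 0) ℚ.* pathSum 1 L ℚ.+ odd 0 ℚ.* conv 0 L) ℚ.+ (1ℚ ℚ.+ fromℕ 0) ℚ.* pathSum 1 L
    ≡⟨ solve 2 (λ w c → (con 0ℚ :* con 0ℚ :- (con 1ℚ :+ con 0ℚ) :* w :+ con 1ℚ :* c) :+ (con 1ℚ :+ con 0ℚ) :* w := c)
         refl (pathSum 1 L) (conv 0 L) ⟩
  conv 0 L ∎
  where
  open ≡-Reasoning
  W = pathSum 0 (suc L)

pathSum-parity : ∀ L h → isEven (h ℕ.+ L) ≡ false → pathSum h L ≡ 0ℚ
pathSum-parity zero    zero    ()
pathSum-parity zero    (suc h) _       = refl
pathSum-parity (suc L) h       h+L+1-odd = begin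
  weightAt h ℚ.* (pathSum (suc h) L ℚ.+ pathSumPred h L)   ≡⟨ cong₂ (λ p q → weightAt h ℚ.* (p ℚ.+ q)) up (down h h+L+1-odd) ⟩
  weightAt h ℚ.* (0ℚ ℚ.+ 0ℚ)                              ≡⟨ solve 1 (λ x → x :* (con 0ℚ :+ con 0ℚ) := con 0ℚ) refl (weightAt h) ⟩
  0ℚ                                                      ∎
  where
  open ≡-Reasoning
  up : pathSum (suc h) L ≡ 0ℚ
  up = pathSum-parity L (suc h) (trans (cong isEven (sym (ℕP.+-suc h L))) h+L+1-odd)
  down : ∀ h → isEven (h ℕ.+ suc L) ≡ false → pathSumPred h L ≡ 0ℚ
  down zero    _         = refl
  down (suc h) h+L+2-odd = pathSum-parity L h (begin
    isEven (h ℕ.+ L)                   ≡⟨ not-involutive (isEven (h ℕ.+ L)) ⟨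
    not (not (isEven (h ℕ.+ L)))       ≡⟨ cong (not ∘ isEven) (ℕP.+-suc h L) ⟨
    isEven (suc h ℕ.+ suc L)           ≡⟨ h+L+2-odd ⟩
    false                              ∎)

dyckSum : ℕ → ℚ
dyckSum n = pathSum 0 (n ℕ.+ n)

dyckSum-tangent : TangentRecurrence dyckSum
dyckSum-tangent m = begin
  fromℕ (suc (suc (m ℕ.+ suc m))) ℚ.* pathSum 0 (suc (m ℕ.+ suc m))  ≡⟨ pathSum-0-recurrence (m ℕ.+ suc m) ⟩
  conv 0 (m ℕ.+ suc m)                                               ≡⟨ cong (conv 0) (ℕP.+-suc m m) ⟩
  antidiag (λ i j → pathSum 0 i ℚ.* pathSum 0 j) (m ℕ.+ m)          ≡⟨ antidiag-even (pathSum 0) (pathSum 0) odd-length m ⟩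
  antidiag (λ i j → dyckSum i ℚ.* dyckSum j) m                       ∎
  where
  open ≡-Reasoning
  odd-length : ∀ i → pathSum 0 (suc (i ℕ.+ i)) ≡ 0ℚ
  odd-length i = pathSum-parity (suc (i ℕ.+ i)) 0 (cong not (isEven-+-self i))

sumBelow : (ℕ → ℕ) → ℕ → ℕ
sumBelow f zero    = 0
sumBelow f (suc a) = sumBelow f a ℕ.+ f a

-- entringer r a counts the ways to continue a zigzag word by r of the r unused letters when a of
-- them lie on the side where the next letter must go.
entringer : ℕ → ℕ → ℕ
entringer zero    a = 1
entringer (suc r) a = sumBelow (λ k → entringer r (r ∸ k)) a

seidel : ℕ → ℕ → ℕ
seidel m n = entringer (m ℕ.+ n) n

seidel-boustrophedon : ∀ m n → seidel m (suc n) ≡ seidel (suc m) n ℕ.+ seidel n m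
seidel-boustrophedon m n = begin
  entringer (m ℕ.+ suc n) (suc n)                           ≡⟨ cong (λ r → entringer r (suc n)) (ℕP.+-suc m n) ⟩
  entringer (suc (m ℕ.+ n)) n ℕ.+ entringer (m ℕ.+ n) (m ℕ.+ n ∸ n)
    ≡⟨ cong (λ k → entringer (suc (m ℕ.+ n)) n ℕ.+ entringer (m ℕ.+ n) k) (ℕP.m+n∸n≡m m n) ⟩
  entringer (suc (m ℕ.+ n)) n ℕ.+ entringer (m ℕ.+ n) m
    ≡⟨ cong (λ r → entringer (suc (m ℕ.+ n)) n ℕ.+ entringer r m) (ℕP.+-comm m n) ⟩
  seidel (suc m) n ℕ.+ seidel n m                           ∎
  where open ≡-Reasoning

invFactorial : ℕ → ℚ
invFactorial n = (+ 1 / (n !)) {{n ℕP.!≢0}}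

factorial-*-invFactorial : ∀ n → fromℕ (n !) ℚ.* invFactorial n ≡ 1ℚ
factorial-*-invFactorial n =
  trans (ℚP.*-comm (fromℕ (n !)) (invFactorial n)) (i/n*n≡i (+ 1) (n !) {{n ℕP.!≢0}})

invFactorial-suc : ∀ k → invFactorial k ≡ fromℕ (suc k) ℚ.* invFactorial (suc k)
invFactorial-suc k = *-cancelˡ-fromℕ (suc k !) {{suc k ℕP.!≢0}} (begin
  fromℕ (suc k !) ℚ.* invFactorial k                        ≡⟨ cong (ℚ._* invFactorial k) (fromℕ-* (suc k) (k !)) ⟩
  fromℕ (suc k) ℚ.* fromℕ (k !) ℚ.* invFactorial k          ≡⟨ ℚP.*-assoc (fromℕ (suc k)) _ _ ⟩
  fromℕ (suc k) ℚ.* (fromℕ (k !) ℚ.* invFactorial k)        ≡⟨ cong (fromℕ (suc k) ℚ.*_) (factorial-*-invFactorial k) ⟩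
  fromℕ (suc k) ℚ.* 1ℚ                                      ≡⟨ cong (fromℕ (suc k) ℚ.*_) (factorial-*-invFactorial (suc k)) ⟨
  fromℕ (suc k) ℚ.* (fromℕ (suc k !) ℚ.* invFactorial (suc k))
    ≡⟨ solve 3 (λ a b c → a :* (b :* c) := b :* (a :* c)) refl (fromℕ (suc k)) (fromℕ (suc k !)) (invFactorial (suc k)) ⟩
  fromℕ (suc k !) ℚ.* (fromℕ (suc k) ℚ.* invFactorial (suc k)) ∎)
  where open ≡-Reasoning

x/n!≡x*invFactorial : ∀ x n → (+ x / (n !)) {{n ℕP.!≢0}} ≡ fromℕ x ℚ.* invFactorial n
x/n!≡x*invFactorial x n = *-cancelˡ-fromℕ (n !) {{n ℕP.!≢0}} (begin
  fromℕ (n !) ℚ.* (+ x / (n !)) {{n ℕP.!≢0}}       ≡⟨ ℚP.*-comm (fromℕ (n !)) _ ⟩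
  (+ x / (n !)) {{n ℕP.!≢0}} ℚ.* fromℕ (n !)       ≡⟨ i/n*n≡i (+ x) (n !) {{n ℕP.!≢0}} ⟩
  fromℕ x                                          ≡⟨ ℚP.*-identityʳ (fromℕ x) ⟨
  fromℕ x ℚ.* 1ℚ                                   ≡⟨ cong (fromℕ x ℚ.*_) (factorial-*-invFactorial n) ⟨
  fromℕ x ℚ.* (fromℕ (n !) ℚ.* invFactorial n)
    ≡⟨ solve 3 (λ a b c → a :* (b :* c) := b :* (a :* c)) refl (fromℕ x) (fromℕ (n !)) (invFactorial n) ⟩
  fromℕ (n !) ℚ.* (fromℕ x ℚ.* invFactorial n)     ∎)
  where open ≡-Reasoning

-- Formal power series in x and y, as arrays of coefficients of x^m y^n.
Series : Set
Series = ℕ → ℕ → ℚ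

_⊛_ : Series → Series → Series
(f ⊛ g) m n = antidiag (λ i i′ → antidiag (λ j j′ → f i j ℚ.* g i′ j′) n) m

∂x ∂y : Series → Series
∂x f m n = fromℕ (suc m) ℚ.* f (suc m) n
∂y f m n = fromℕ (suc n) ℚ.* f m (suc n)

Transport : Series → Set
Transport X = ∀ m n → ∂y X m n ≡ ∂x X m n ℚ.+ X n m

∂y-⊛ : ∀ f g m n → ∂y (f ⊛ g) m n ≡ (∂y f ⊛ g) m n ℚ.+ (f ⊛ ∂y g) m n
∂y-⊛ f g m n = begin
  fromℕ (suc n) ℚ.* (f ⊛ g) m (suc n)                                              ≡⟨ antidiag-*ˡ (fromℕ (suc n)) _ m ⟨
  antidiag (λ i i′ → fromℕ (suc n) ℚ.* antidiag (λ j j′ → f i j ℚ.* g i′ j′) (suc n)) m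
    ≡⟨ antidiag-cong m (λ i i′ _ → trans (antidiag-leibniz (λ j j′ → f i j ℚ.* g i′ j′) n)
         (cong₂ ℚ._+_ (antidiag-cong n (λ j j′ _ → sym (ℚP.*-assoc (fromℕ (suc j)) (f i (suc j)) (g i′ j′))))
                      (antidiag-cong n (λ j j′ _ → solve 3 (λ a b c → a :* (b :* c) := b :* (a :* c)) refl
                         (fromℕ (suc j′)) (f i j) (g i′ (suc j′)))))) ⟩
  antidiag (λ i i′ → antidiag (λ j j′ → ∂y f i j ℚ.* g i′ j′) n ℚ.+ antidiag (λ j j′ → f i j ℚ.* ∂y g i′ j′) n) m
    ≡⟨ antidiag-+ _ _ m ⟩
  (∂y f ⊛ g) m n ℚ.+ (f ⊛ ∂y g) m n                                               ∎
  where open ≡-Reasoning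

∂x-⊛ : ∀ f g m n → ∂x (f ⊛ g) m n ≡ (∂x f ⊛ g) m n ℚ.+ (f ⊛ ∂x g) m n
∂x-⊛ f g m n = trans (antidiag-leibniz (λ i i′ → antidiag (λ j j′ → f i j ℚ.* g i′ j′) n) m)
  (cong₂ ℚ._+_
    (antidiag-cong m (λ i i′ _ → trans (sym (antidiag-*ˡ (fromℕ (suc i)) _ n))
      (antidiag-cong n (λ j j′ _ → sym (ℚP.*-assoc (fromℕ (suc i)) (f (suc i) j) (g i′ j′))))))
    (antidiag-cong m (λ i i′ _ → trans (sym (antidiag-*ˡ (fromℕ (suc i′)) _ n))
      (antidiag-cong n (λ j j′ _ → solve 3 (λ a b c → a :* (b :* c) := b :* (a :* c)) refl
        (fromℕ (suc i′)) (f i j) (g (suc i′) j′))))))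

⊛-congˡ : ∀ {f f′} g m n → (∀ i j → f i j ≡ f′ i j) → (f ⊛ g) m n ≡ (f′ ⊛ g) m n
⊛-congˡ g m n eq = antidiag-cong m (λ i i′ _ → antidiag-cong n (λ j j′ _ → cong (ℚ._* g i′ j′) (eq i j)))

⊛-congʳ : ∀ f {g g′} m n → (∀ i j → g i j ≡ g′ i j) → (f ⊛ g) m n ≡ (f ⊛ g′) m n
⊛-congʳ f m n eq = antidiag-cong m (λ i i′ _ → antidiag-cong n (λ j j′ _ → cong (f i j ℚ.*_) (eq i′ j′)))

⊛-distribʳ-+ : ∀ f f′ g m n → ((λ i j → f i j ℚ.+ f′ i j) ⊛ g) m n ≡ (f ⊛ g) m n ℚ.+ (f′ ⊛ g) m n
⊛-distribʳ-+ f f′ g m n = trans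
  (antidiag-cong m (λ i i′ _ → trans (antidiag-cong n (λ j j′ _ → ℚP.*-distribʳ-+ (g i′ j′) (f i j) (f′ i j)))
    (antidiag-+ _ _ n)))
  (antidiag-+ _ _ m)

⊛-transpose : ∀ f g m n → (∀ p q → g p q ≡ g q p) → ((λ i j → f j i) ⊛ g) m n ≡ (f ⊛ g) n m
⊛-transpose f g m n g-sym = trans (antidiag-interchange (λ i i′ j j′ → f j i ℚ.* g i′ j′) m n)
  (antidiag-cong n (λ j j′ _ → antidiag-cong m (λ i i′ _ → cong (f j i ℚ.*_) (g-sym i′ j′))))

⊛-transport : ∀ f g → Transport f → (∀ p q → ∂y g p q ≡ ∂x g p q) → (∀ p q → g p q ≡ g q p) → Transport (f ⊛ g)
⊛-transport f g transport-f ∂y≡∂x g-sym m n = begin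
  ∂y (f ⊛ g) m n                                                           ≡⟨ ∂y-⊛ f g m n ⟩
  (∂y f ⊛ g) m n ℚ.+ (f ⊛ ∂y g) m n
    ≡⟨ cong₂ ℚ._+_ (trans (⊛-congˡ g m n transport-f) (⊛-distribʳ-+ (∂x f) (λ i j → f j i) g m n)) (⊛-congʳ f m n ∂y≡∂x) ⟩
  ((∂x f ⊛ g) m n ℚ.+ ((λ i j → f j i) ⊛ g) m n) ℚ.+ (f ⊛ ∂x g) m n
    ≡⟨ cong (λ q → ((∂x f ⊛ g) m n ℚ.+ q) ℚ.+ (f ⊛ ∂x g) m n) (⊛-transpose f g m n g-sym) ⟩
  ((∂x f ⊛ g) m n ℚ.+ (f ⊛ g) n m) ℚ.+ (f ⊛ ∂x g) m n
    ≡⟨ solve 3 (λ a b c → (a :+ b) :+ c := (a :+ c) :+ b) refl ((∂x f ⊛ g) m n) ((f ⊛ g) n m) ((f ⊛ ∂x g) m n) ⟩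
  ((∂x f ⊛ g) m n ℚ.+ (f ⊛ ∂x g) m n) ℚ.+ (f ⊛ g) n m                      ≡⟨ cong (ℚ._+ (f ⊛ g) n m) (∂x-⊛ f g m n) ⟨
  ∂x (f ⊛ g) m n ℚ.+ (f ⊛ g) n m                                            ∎
  where open ≡-Reasoning

sign : ℕ → ℚ
sign k = if isEven k then 1ℚ else ℚ.- 1ℚ

sign-suc : ∀ k → sign (suc k) ≡ ℚ.- sign k
sign-suc k with isEven k
... | true  = refl
... | false = refl

Transport-+ : ∀ {X Y} → Transport X → Transport Y → Transport (λ m n → X m n ℚ.+ Y m n)
Transport-+ {X} {Y} transport-X transport-Y m n = begin
  fromℕ (suc n) ℚ.* (X m (suc n) ℚ.+ Y m (suc n))  ≡⟨ ℚP.*-distribˡ-+ (fromℕ (suc n)) _ _ ⟩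
  ∂y X m n ℚ.+ ∂y Y m n                             ≡⟨ cong₂ ℚ._+_ (transport-X m n) (transport-Y m n) ⟩
  (∂x X m n ℚ.+ X n m) ℚ.+ (∂x Y m n ℚ.+ Y n m)
    ≡⟨ solve 5 (λ a x₁ x₂ y₁ y₂ → (a :* x₁ :+ x₂) :+ (a :* y₁ :+ y₂) := a :* (x₁ :+ y₁) :+ (x₂ :+ y₂)) refl
         (fromℕ (suc m)) (X (suc m) n) (X n m) (Y (suc m) n) (Y n m) ⟩
  fromℕ (suc m) ℚ.* (X (suc m) n ℚ.+ Y (suc m) n) ℚ.+ (X n m ℚ.+ Y n m) ∎
  where open ≡-Reasoning

Transport-− : ∀ {X Y} → Transport X → Transport Y → Transport (λ m n → X m n ℚ.- Y m n)
Transport-− {X} {Y} transport-X transport-Y m n = begin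
  fromℕ (suc n) ℚ.* (X m (suc n) ℚ.- Y m (suc n))
    ≡⟨ solve 3 (λ a x y → a :* (x :- y) := a :* x :- a :* y) refl (fromℕ (suc n)) (X m (suc n)) (Y m (suc n)) ⟩
  ∂y X m n ℚ.- ∂y Y m n                             ≡⟨ cong₂ ℚ._-_ (transport-X m n) (transport-Y m n) ⟩
  (∂x X m n ℚ.+ X n m) ℚ.- (∂x Y m n ℚ.+ Y n m)
    ≡⟨ solve 5 (λ a x₁ x₂ y₁ y₂ → (a :* x₁ :+ x₂) :- (a :* y₁ :+ y₂) := a :* (x₁ :- y₁) :+ (x₂ :- y₂)) refl
         (fromℕ (suc m)) (X (suc m) n) (X n m) (Y (suc m) n) (Y n m) ⟩
  fromℕ (suc m) ℚ.* (X (suc m) n ℚ.- Y (suc m) n) ℚ.+ (X n m ℚ.- Y n m) ∎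
  where open ≡-Reasoning

∂diag : Series → Series
∂diag X m n = ∂x X m n ℚ.+ ∂y X m n

Transport-∂diag : ∀ {X} → Transport X → Transport (∂diag X)
Transport-∂diag {X} transport-X m n = begin
  fromℕ (suc n) ℚ.* (fromℕ (suc m) ℚ.* P ℚ.+ ∂y X m (suc n))
    ≡⟨ solve 4 (λ a b x y → a :* (b :* x :+ y) := a :* b :* x :+ a :* y) refl (fromℕ (suc n)) (fromℕ (suc m)) P (∂y X m (suc n)) ⟩
  fromℕ (suc n) ℚ.* fromℕ (suc m) ℚ.* P ℚ.+ fromℕ (suc n) ℚ.* ∂y X m (suc n)
    ≡⟨ cong (λ q → fromℕ (suc n) ℚ.* fromℕ (suc m) ℚ.* P ℚ.+ fromℕ (suc n) ℚ.* q) (transport-X m (suc n)) ⟩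
  fromℕ (suc n) ℚ.* fromℕ (suc m) ℚ.* P ℚ.+ fromℕ (suc n) ℚ.* (fromℕ (suc m) ℚ.* P ℚ.+ Q)
    ≡⟨ solve 4 (λ a b x y → a :* b :* x :+ a :* (b :* x :+ y) := b :* (a :* x) :+ a :* b :* x :+ a :* y) refl
         (fromℕ (suc n)) (fromℕ (suc m)) P Q ⟩
  fromℕ (suc m) ℚ.* ∂y X (suc m) n ℚ.+ fromℕ (suc n) ℚ.* fromℕ (suc m) ℚ.* P ℚ.+ fromℕ (suc n) ℚ.* Q
    ≡⟨ cong (λ q → fromℕ (suc m) ℚ.* q ℚ.+ fromℕ (suc n) ℚ.* fromℕ (suc m) ℚ.* P ℚ.+ fromℕ (suc n) ℚ.* Q)
         (transport-X (suc m) n) ⟩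
  fromℕ (suc m) ℚ.* (fromℕ (suc (suc m)) ℚ.* R ℚ.+ S) ℚ.+ fromℕ (suc n) ℚ.* fromℕ (suc m) ℚ.* P ℚ.+ fromℕ (suc n) ℚ.* Q
    ≡⟨ solve 7 (λ a b c x y z u → b :* (c :* z :+ u) :+ a :* b :* x :+ a :* y := b :* (c :* z :+ a :* x) :+ (a :* y :+ b :* u))
         refl (fromℕ (suc n)) (fromℕ (suc m)) (fromℕ (suc (suc m))) P Q R S ⟩
  ∂x (∂diag X) m n ℚ.+ ∂diag X n m ∎
  where
  open ≡-Reasoning
  P = X (suc m) (suc n)
  Q = X (suc n) m
  R = X (suc (suc m)) n
  S = X n (suc m)

-- X(-y,-x)
reflect : Series → Series
reflect X m n = sign (m ℕ.+ n) ℚ.* X n m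

Transport-reflect : ∀ {X} → Transport X → Transport (reflect X)
Transport-reflect {X} transport-X m n = begin
  fromℕ (suc n) ℚ.* (sign (m ℕ.+ suc n) ℚ.* X (suc n) m)
    ≡⟨ cong (λ s → fromℕ (suc n) ℚ.* (s ℚ.* X (suc n) m)) (trans (cong sign (ℕP.+-suc m n)) (sign-suc (m ℕ.+ n))) ⟩
  fromℕ (suc n) ℚ.* (ℚ.- s ℚ.* X (suc n) m)
    ≡⟨ solve 4 (λ a s x y → a :* (:- s :* x) := :- s :* (a :* x :+ y) :+ s :* y) refl (fromℕ (suc n)) s (X (suc n) m) (X m n) ⟩
  ℚ.- s ℚ.* (∂x X n m ℚ.+ X m n) ℚ.+ s ℚ.* X m n
    ≡⟨ cong (λ q → ℚ.- s ℚ.* q ℚ.+ s ℚ.* X m n) (transport-X n m) ⟨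
  ℚ.- s ℚ.* (fromℕ (suc m) ℚ.* X n (suc m)) ℚ.+ s ℚ.* X m n
    ≡⟨ solve 4 (λ a s x y → :- s :* (a :* x) :+ s :* y := a :* (:- s :* x) :+ s :* y) refl (fromℕ (suc m)) s (X n (suc m)) (X m n) ⟩
  fromℕ (suc m) ℚ.* (ℚ.- s ℚ.* X n (suc m)) ℚ.+ s ℚ.* X m n
    ≡⟨ cong₂ (λ s′ s″ → fromℕ (suc m) ℚ.* (s′ ℚ.* X n (suc m)) ℚ.+ s″ ℚ.* X m n)
         (sym (sign-suc (m ℕ.+ n))) (cong sign (ℕP.+-comm m n)) ⟩
  ∂x (reflect X) m n ℚ.+ reflect X n m ∎
  where
  open ≡-Reasoning
  s = sign (m ℕ.+ n)

Transport-unique : ∀ {X} → Transport X → (∀ m → X m 0 ≡ 0ℚ) → ∀ m n → X m n ≡ 0ℚ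
Transport-unique {X} transport-X X₀≡0 m n = vanish (m ℕ.+ n) n m refl
  where
  open ≡-Reasoning
  vanish : ∀ d n m → m ℕ.+ n ≡ d → X m n ≡ 0ℚ
  vanish d       zero    m _  = X₀≡0 m
  vanish zero    (suc n) m eq = ⊥-elim (ℕP.0≢1+n (trans (sym eq) (ℕP.+-suc m n)))
  vanish (suc d) (suc n) m eq = *-cancelˡ-fromℕ (suc n) (begin
    ∂y X m n                             ≡⟨ transport-X m n ⟩
    fromℕ (suc m) ℚ.* X (suc m) n ℚ.+ X n m
      ≡⟨ cong₂ (λ p q → fromℕ (suc m) ℚ.* p ℚ.+ q)
           (vanish (suc d) n (suc m) (trans (sym (ℕP.+-suc m n)) eq))
           (vanish d m n (trans (ℕP.+-comm n m) (ℕP.suc-injective (trans (sym (ℕP.+-suc m n)) eq)))) ⟩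
    fromℕ (suc m) ℚ.* 0ℚ ℚ.+ 0ℚ
      ≡⟨ solve 2 (λ a b → a :* con 0ℚ :+ con 0ℚ := b :* con 0ℚ) refl (fromℕ (suc m)) (fromℕ (suc n)) ⟩
    fromℕ (suc n) ℚ.* 0ℚ                 ∎)

seidelCoeff : Series
seidelCoeff m n = fromℕ (seidel m n) ℚ.* invFactorial m ℚ.* invFactorial n

seidelCoeff-transport : Transport seidelCoeff
seidelCoeff-transport m n = begin
  fromℕ (suc n) ℚ.* (fromℕ (seidel m (suc n)) ℚ.* invFactorial m ℚ.* invFactorial (suc n))
    ≡⟨ solve 4 (λ a b c d → a :* (b :* c :* d) := b :* c :* (a :* d)) refl
         (fromℕ (suc n)) (fromℕ (seidel m (suc n))) (invFactorial m) (invFactorial (suc n)) ⟩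
  fromℕ (seidel m (suc n)) ℚ.* invFactorial m ℚ.* (fromℕ (suc n) ℚ.* invFactorial (suc n))
    ≡⟨ cong₂ (λ p q → fromℕ p ℚ.* invFactorial m ℚ.* q) (seidel-boustrophedon m n) (sym (invFactorial-suc n)) ⟩
  fromℕ (seidel (suc m) n ℕ.+ seidel n m) ℚ.* invFactorial m ℚ.* invFactorial n
    ≡⟨ cong (λ p → p ℚ.* invFactorial m ℚ.* invFactorial n) (fromℕ-+ (seidel (suc m) n) (seidel n m)) ⟩
  (fromℕ (seidel (suc m) n) ℚ.+ fromℕ (seidel n m)) ℚ.* invFactorial m ℚ.* invFactorial n
    ≡⟨ solve 4 (λ a b c f → (a :+ b) :* c :* f := a :* c :* f :+ b :* f :* c) refl
         (fromℕ (seidel (suc m) n)) (fromℕ (seidel n m)) (invFactorial m) (invFactorial n) ⟩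
  fromℕ (seidel (suc m) n) ℚ.* invFactorial m ℚ.* invFactorial n ℚ.+ seidelCoeff n m
    ≡⟨ cong (λ q → fromℕ (seidel (suc m) n) ℚ.* q ℚ.* invFactorial n ℚ.+ seidelCoeff n m) (invFactorial-suc m) ⟩
  fromℕ (seidel (suc m) n) ℚ.* (fromℕ (suc m) ℚ.* invFactorial (suc m)) ℚ.* invFactorial n ℚ.+ seidelCoeff n m
    ≡⟨ cong (ℚ._+ seidelCoeff n m) (solve 4 (λ a c d f → a :* (c :* d) :* f := c :* (a :* d :* f)) refl
         (fromℕ (seidel (suc m) n)) (fromℕ (suc m)) (invFactorial (suc m)) (invFactorial n)) ⟩
  ∂x seidelCoeff m n ℚ.+ seidelCoeff n m ∎
  where open ≡-Reasoning

tangentNumber : ℕ → ℕ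
tangentNumber k = if isEven k then 0 else seidel 0 k

-- The coefficients of tan(x+y): for odd k, seidel 0 k is the tangent number E_k.
tanCoeff : Series
tanCoeff p q = fromℕ (tangentNumber (p ℕ.+ q)) ℚ.* invFactorial p ℚ.* invFactorial q

tanCoeff-sym : ∀ p q → tanCoeff p q ≡ tanCoeff q p
tanCoeff-sym p q = trans (cong (λ k → fromℕ (tangentNumber k) ℚ.* invFactorial p ℚ.* invFactorial q) (ℕP.+-comm p q))
  (solve 3 (λ a b c → a :* b :* c := a :* c :* b) refl (fromℕ (tangentNumber (q ℕ.+ p))) (invFactorial p) (invFactorial q))

∂y-tanCoeff : ∀ p q → ∂y tanCoeff p q ≡ ∂x tanCoeff p q
∂y-tanCoeff p q = begin
  fromℕ (suc q) ℚ.* (fromℕ (tangentNumber (p ℕ.+ suc q)) ℚ.* invFactorial p ℚ.* invFactorial (suc q))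
    ≡⟨ solve 4 (λ a b c d → a :* (b :* c :* d) := b :* c :* (a :* d)) refl
         (fromℕ (suc q)) (fromℕ (tangentNumber (p ℕ.+ suc q))) (invFactorial p) (invFactorial (suc q)) ⟩
  fromℕ (tangentNumber (p ℕ.+ suc q)) ℚ.* invFactorial p ℚ.* (fromℕ (suc q) ℚ.* invFactorial (suc q))
    ≡⟨ cong₂ (λ k y → fromℕ (tangentNumber k) ℚ.* invFactorial p ℚ.* y) (ℕP.+-suc p q) (sym (invFactorial-suc q)) ⟩
  fromℕ (tangentNumber (suc p ℕ.+ q)) ℚ.* invFactorial p ℚ.* invFactorial q
    ≡⟨ cong (λ y → fromℕ (tangentNumber (suc p ℕ.+ q)) ℚ.* y ℚ.* invFactorial q) (invFactorial-suc p) ⟩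
  fromℕ (tangentNumber (suc p ℕ.+ q)) ℚ.* (fromℕ (suc p) ℚ.* invFactorial (suc p)) ℚ.* invFactorial q
    ≡⟨ solve 4 (λ a b c d → a :* (b :* c) :* d := b :* (a :* c :* d)) refl
         (fromℕ (tangentNumber (suc p ℕ.+ q))) (fromℕ (suc p)) (invFactorial (suc p)) (invFactorial q) ⟩
  ∂x tanCoeff p q ∎
  where open ≡-Reasoning

seidelDefect : Series
seidelDefect m n = ∂diag seidelCoeff m n ℚ.- reflect seidelCoeff m n ℚ.- ((seidelCoeff ⊛ tanCoeff) m n ℚ.+ (seidelCoeff ⊛ tanCoeff) m n)

seidelDefect-transport : Transport seidelDefect
seidelDefect-transport = Transport-− (Transport-− (Transport-∂diag seidelCoeff-transport) (Transport-reflect seidelCoeff-transport))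
  (Transport-+ e⊛t-transport e⊛t-transport)
  where e⊛t-transport = ⊛-transport seidelCoeff tanCoeff seidelCoeff-transport ∂y-tanCoeff tanCoeff-sym

seidelCoeff-suc-0 : ∀ m → seidelCoeff (suc m) 0 ≡ 0ℚ
seidelCoeff-suc-0 m = solve 2 (λ a b → con 0ℚ :* a :* b := con 0ℚ) refl (invFactorial (suc m)) (invFactorial 0)

∂diag-seidelCoeff-0 : ∀ m → ∂diag seidelCoeff m 0 ≡ seidelCoeff 0 m
∂diag-seidelCoeff-0 m = begin
  ∂x seidelCoeff m 0 ℚ.+ ∂y seidelCoeff m 0                       ≡⟨ cong (∂x seidelCoeff m 0 ℚ.+_) (seidelCoeff-transport m 0) ⟩
  ∂x seidelCoeff m 0 ℚ.+ (∂x seidelCoeff m 0 ℚ.+ seidelCoeff 0 m)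
    ≡⟨ cong (λ x → fromℕ (suc m) ℚ.* x ℚ.+ (fromℕ (suc m) ℚ.* x ℚ.+ seidelCoeff 0 m)) (seidelCoeff-suc-0 m) ⟩
  fromℕ (suc m) ℚ.* 0ℚ ℚ.+ (fromℕ (suc m) ℚ.* 0ℚ ℚ.+ seidelCoeff 0 m)
    ≡⟨ solve 2 (λ a x → a :* con 0ℚ :+ (a :* con 0ℚ :+ x) := x) refl (fromℕ (suc m)) (seidelCoeff 0 m) ⟩
  seidelCoeff 0 m                                                  ∎
  where open ≡-Reasoning

seidelCoeff⊛tanCoeff-0 : ∀ m → (seidelCoeff ⊛ tanCoeff) m 0 ≡ tanCoeff m 0
seidelCoeff⊛tanCoeff-0 m = begin
  antidiag (λ i i′ → seidelCoeff i 0 ℚ.* tanCoeff i′ 0) m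
    ≡⟨ antidiag-head _ m (λ i i′ → trans (cong (ℚ._* tanCoeff i′ 0) (seidelCoeff-suc-0 i)) (ℚP.*-zeroˡ (tanCoeff i′ 0))) ⟩
  1ℚ ℚ.* tanCoeff m 0   ≡⟨ ℚP.*-identityˡ (tanCoeff m 0) ⟩
  tanCoeff m 0          ∎
  where open ≡-Reasoning

seidelDefect-0 : ∀ m → seidelDefect m 0 ≡ 0ℚ
seidelDefect-0 m = begin
  seidelDefect m 0
    ≡⟨ cong₂ (λ a b → a ℚ.- reflect seidelCoeff m 0 ℚ.- (b ℚ.+ b)) (∂diag-seidelCoeff-0 m) (seidelCoeff⊛tanCoeff-0 m) ⟩
  seidelCoeff 0 m ℚ.- sign (m ℕ.+ 0) ℚ.* seidelCoeff 0 m ℚ.- (tanCoeff m 0 ℚ.+ tanCoeff m 0)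
    ≡⟨ parity-cancel m ⟩
  0ℚ ∎
  where
  open ≡-Reasoning
  parity-cancel : ∀ m → seidelCoeff 0 m ℚ.- sign (m ℕ.+ 0) ℚ.* seidelCoeff 0 m ℚ.- (tanCoeff m 0 ℚ.+ tanCoeff m 0) ≡ 0ℚ
  parity-cancel m rewrite ℕP.+-identityʳ m with isEven m
  ... | true  = solve 3 (λ x p q → x :* p :* q :- con 1ℚ :* (x :* p :* q) :- (con 0ℚ :* q :* p :+ con 0ℚ :* q :* p) := con 0ℚ)
                  refl (fromℕ (seidel 0 m)) (invFactorial 0) (invFactorial m)
  ... | false = solve 3 (λ x p q → x :* p :* q :- (:- con 1ℚ) :* (x :* p :* q) :- (x :* q :* p :+ x :* q :* p) := con 0ℚ)
                  refl (fromℕ (seidel 0 m)) (invFactorial 0) (invFactorial m)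

seidelCoeff-equation : ∀ m n →
  ∂diag seidelCoeff m n ≡ reflect seidelCoeff m n ℚ.+ ((seidelCoeff ⊛ tanCoeff) m n ℚ.+ (seidelCoeff ⊛ tanCoeff) m n)
seidelCoeff-equation m n = begin
  a                                 ≡⟨ solve 3 (λ a h b → a := (a :- h :- b) :+ (h :+ b)) refl a h b ⟩
  seidelDefect m n ℚ.+ (h ℚ.+ b)    ≡⟨ cong (ℚ._+ (h ℚ.+ b)) (Transport-unique seidelDefect-transport seidelDefect-0 m n) ⟩
  0ℚ ℚ.+ (h ℚ.+ b)                  ≡⟨ ℚP.+-identityˡ (h ℚ.+ b) ⟩
  h ℚ.+ b                           ∎
  where
  open ≡-Reasoning
  a = ∂diag seidelCoeff m n
  h = reflect seidelCoeff m n
  b = (seidelCoeff ⊛ tanCoeff) m n ℚ.+ (seidelCoeff ⊛ tanCoeff) m n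

seidelCoeff-0-recurrence : ∀ n → ∂y seidelCoeff 0 (suc n) ≡ (seidelCoeff ⊛ tanCoeff) 0 (suc n)
seidelCoeff-0-recurrence n = begin
  X               ≡⟨ solve 1 (λ x → x := con ½ :* (x :+ x)) refl X ⟩
  ½ ℚ.* (X ℚ.+ X) ≡⟨ cong (½ ℚ.*_) doubled ⟩
  ½ ℚ.* (Y ℚ.+ Y) ≡⟨ solve 1 (λ y → con ½ :* (y :+ y) := y) refl Y ⟩
  Y               ∎
  where
  open ≡-Reasoning
  X = ∂y seidelCoeff 0 (suc n)
  Y = (seidelCoeff ⊛ tanCoeff) 0 (suc n)
  ∂x≡∂y : ∂x seidelCoeff 0 (suc n) ≡ X
  ∂x≡∂y = begin
    ∂x seidelCoeff 0 (suc n)                            ≡⟨ ℚP.+-identityʳ _ ⟨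
    ∂x seidelCoeff 0 (suc n) ℚ.+ 0ℚ                     ≡⟨ cong (∂x seidelCoeff 0 (suc n) ℚ.+_) (seidelCoeff-suc-0 n) ⟨
    ∂x seidelCoeff 0 (suc n) ℚ.+ seidelCoeff (suc n) 0  ≡⟨ seidelCoeff-transport 0 (suc n) ⟨
    X                                                   ∎
  doubled : X ℚ.+ X ≡ Y ℚ.+ Y
  doubled = begin
    X ℚ.+ X                                              ≡⟨ cong (ℚ._+ X) ∂x≡∂y ⟨
    ∂diag seidelCoeff 0 (suc n)                          ≡⟨ seidelCoeff-equation 0 (suc n) ⟩
    sign (suc n) ℚ.* seidelCoeff (suc n) 0 ℚ.+ (Y ℚ.+ Y) ≡⟨ cong (λ z → sign (suc n) ℚ.* z ℚ.+ (Y ℚ.+ Y)) (seidelCoeff-suc-0 n) ⟩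
    sign (suc n) ℚ.* 0ℚ ℚ.+ (Y ℚ.+ Y)                    ≡⟨ solve 2 (λ s y → s :* con 0ℚ :+ y := y) refl (sign (suc n)) (Y ℚ.+ Y) ⟩
    Y ℚ.+ Y                                              ∎

tanCoeff-0-even : ∀ k → isEven k ≡ true → tanCoeff 0 k ≡ 0ℚ
tanCoeff-0-even k even rewrite even = solve 2 (λ a b → con 0ℚ :* a :* b := con 0ℚ) refl (invFactorial 0) (invFactorial k)

tanCoeff-0-odd : ∀ k → isEven k ≡ false → tanCoeff 0 k ≡ seidelCoeff 0 k
tanCoeff-0-odd k k-odd rewrite k-odd = refl

oddEulerRatio : ℕ → ℚ
oddEulerRatio n = seidelCoeff 0 (suc (n ℕ.+ n))

oddEulerRatio-tangent : TangentRecurrence oddEulerRatio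
oddEulerRatio-tangent m = begin
  ∂y seidelCoeff 0 (suc (m ℕ.+ suc m))                       ≡⟨ seidelCoeff-0-recurrence (m ℕ.+ suc m) ⟩
  seidelCoeff 0 0 ℚ.* tanCoeff 0 (suc (m ℕ.+ suc m)) ℚ.+ antidiag F (m ℕ.+ suc m)
    ≡⟨ cong₂ (λ p q → seidelCoeff 0 0 ℚ.* p ℚ.+ q)
         (tanCoeff-0-even (suc m ℕ.+ suc m) (isEven-+-self (suc m))) (cong (antidiag F) (ℕP.+-suc m m)) ⟩
  seidelCoeff 0 0 ℚ.* 0ℚ ℚ.+ antidiag F (suc (m ℕ.+ m))
    ≡⟨ cong (seidelCoeff 0 0 ℚ.* 0ℚ ℚ.+_) (antidiag-snoc F (m ℕ.+ m)) ⟩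
  seidelCoeff 0 0 ℚ.* 0ℚ ℚ.+ (antidiag (λ j j′ → F j (suc j′)) (m ℕ.+ m) ℚ.+ Last ℚ.* tanCoeff 0 0)
    ≡⟨ cong₂ (λ p q → seidelCoeff 0 0 ℚ.* 0ℚ ℚ.+ (p ℚ.+ Last ℚ.* q)) oddTerms (tanCoeff-0-even 0 refl) ⟩
  seidelCoeff 0 0 ℚ.* 0ℚ ℚ.+ (antidiag (λ a b → oddEulerRatio a ℚ.* oddEulerRatio b) m ℚ.+ Last ℚ.* 0ℚ)
    ≡⟨ solve 3 (λ a x y → a :* con 0ℚ :+ (x :+ y :* con 0ℚ) := x) refl
         (seidelCoeff 0 0) (antidiag (λ a b → oddEulerRatio a ℚ.* oddEulerRatio b) m) Last ⟩
  antidiag (λ a b → oddEulerRatio a ℚ.* oddEulerRatio b) m ∎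
  where
  open ≡-Reasoning
  F = λ j j′ → seidelCoeff 0 (suc j) ℚ.* tanCoeff 0 j′
  Last = seidelCoeff 0 (suc (suc (m ℕ.+ m)))
  isEven-suc-suc-+-self : ∀ i → isEven (suc (suc (i ℕ.+ i))) ≡ true
  isEven-suc-suc-+-self i = trans (not-involutive (isEven (i ℕ.+ i))) (isEven-+-self i)
  oddTerms : antidiag (λ j j′ → F j (suc j′)) (m ℕ.+ m) ≡ antidiag (λ a b → oddEulerRatio a ℚ.* oddEulerRatio b) m
  oddTerms = trans
    (antidiag-even (λ j → seidelCoeff 0 (suc j)) (λ j → tanCoeff 0 (suc j))
      (λ i → tanCoeff-0-even (suc (suc (i ℕ.+ i))) (isEven-suc-suc-+-self i)) m)
    (antidiag-cong m (λ a b _ → cong (oddEulerRatio a ℚ.*_) (tanCoeff-0-odd (suc (b ℕ.+ b)) (cong not (isEven-+-self b)))))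

length-filter-++ : ∀ {A : Set} {P : Pred A 0ℓ} (P? : Decidable P) xs ys →
                   length (filter P? (xs ++ ys)) ≡ length (filter P? xs) ℕ.+ length (filter P? ys)
length-filter-++ P? xs ys = trans (cong length (LP.filter-++ P? xs ys)) (LP.length-++ (filter P? xs))

length-filter-concatMap : ∀ {A B : Set} {P : Pred B 0ℓ} (P? : Decidable P) (f : A → List B) xs →
                          length (filter P? (concatMap f xs)) ≡ sum (map (λ x → length (filter P? (f x))) xs)
length-filter-concatMap P? f []       = refl
length-filter-concatMap P? f (x ∷ xs) = trans (length-filter-++ P? (f x) (concatMap f xs))
  (cong (length (filter P? (f x)) ℕ.+_) (length-filter-concatMap P? f xs))

length-filter-map : ∀ {A B : Set} {P : Pred B 0ℓ} (P? : Decidable P) (f : A → B) xs →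
                    length (filter P? (map f xs)) ≡ length (filter (P? ∘ f) xs)
length-filter-map P? f []       = refl
length-filter-map P? f (x ∷ xs) with does (P? (f x))
... | true  = cong suc (length-filter-map P? f xs)
... | false = length-filter-map P? f xs

length-filter-×-dec : ∀ {A C : Set} {P : Pred A 0ℓ} (C? : Dec C) (P? : Decidable P) xs →
  length (filter (λ x → C? ×-dec P? x) xs) ≡ (if does C? then length (filter P? xs) else 0)
length-filter-×-dec (no _)  P? []       = refl
length-filter-×-dec (yes _) P? []       = refl
length-filter-×-dec (no c)  P? (x ∷ xs) = length-filter-×-dec (no c) P? xs
length-filter-×-dec (yes c) P? (x ∷ xs) with does (P? x)
... | true  = cong suc (length-filter-×-dec (yes c) P? xs)
... | false = length-filter-×-dec (yes c) P? xs

sumBelow-cong : ∀ {f g : ℕ → ℕ} M → (∀ i → i < M → f i ≡ g i) → sumBelow f M ≡ sumBelow g M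
sumBelow-cong zero    eq = refl
sumBelow-cong (suc M) eq = cong₂ ℕ._+_ (sumBelow-cong M (λ i i<M → eq i (ℕP.m<n⇒m<1+n i<M))) (eq M ℕP.≤-refl)

sumBelow-split-head : ∀ (f : ℕ → ℕ) M → sumBelow f (suc M) ≡ f 0 ℕ.+ sumBelow (f ∘ suc) M
sumBelow-split-head f zero    = ℕP.+-comm 0 (f 0)
sumBelow-split-head f (suc M) = trans (cong (ℕ._+ f (suc M)) (sumBelow-split-head f M)) (ℕP.+-assoc (f 0) _ _)

sumBelow-+ : ∀ (f g : ℕ → ℕ) M → sumBelow (λ i → f i ℕ.+ g i) M ≡ sumBelow f M ℕ.+ sumBelow g M
sumBelow-+ f g zero    = refl
sumBelow-+ f g (suc M) = trans (cong (ℕ._+ (f M ℕ.+ g M)) (sumBelow-+ f g M))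
  (interchange (sumBelow f M) (sumBelow g M) (f M) (g M))

sum-tabulate-toℕ : ∀ M (f : ℕ → ℕ) → sum (tabulate (f ∘ toℕ {M})) ≡ sumBelow f M
sum-tabulate-toℕ zero    f = refl
sum-tabulate-toℕ (suc M) f = trans (cong (f 0 ℕ.+_) (sum-tabulate-toℕ M (f ∘ suc))) (sym (sumBelow-split-head f M))

sum-allFin : ∀ M (f : ℕ → ℕ) → sum (map (f ∘ toℕ) (allFin M)) ≡ sumBelow f M
sum-allFin M f = trans (cong sum (LP.map-tabulate {n = M} id (f ∘ toℕ))) (sum-tabulate-toℕ M f)

⟦_⟧ : Bool → ℕ
⟦ b ⟧ = if b then 1 else 0

countBelow : (ℕ → Bool) → ℕ → ℕ
countBelow p n = sumBelow (λ i → ⟦ p i ⟧) n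

⟦∧⟧-false : ∀ a {b} → b ≡ false → ⟦ a ∧ b ⟧ ≡ 0
⟦∧⟧-false a refl = cong ⟦_⟧ (∧-zeroʳ a)

⟦∧⟧-true : ∀ a {b} → b ≡ true → ⟦ a ∧ b ⟧ ≡ ⟦ a ⟧
⟦∧⟧-true a refl = cong ⟦_⟧ (∧-identityʳ a)

countBelow-all : ∀ M → countBelow (λ _ → true) M ≡ M
countBelow-all zero    = refl
countBelow-all (suc M) = trans (cong (ℕ._+ 1) (countBelow-all M)) (ℕP.+-comm M 1)

countBelow-∧-< : ∀ (p : ℕ → Bool) n M → n ≤ M → countBelow (λ i → p i ∧ does (i <? n)) M ≡ countBelow p n
countBelow-∧-< p n zero    z≤n = refl
countBelow-∧-< p n (suc M) n≤1+M with n ≟ suc M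
... | yes refl = sumBelow-cong (suc M) (λ i i<n → ⟦∧⟧-true (p i) (dec-true (i <? suc M) i<n))
... | no n≢1+M = trans (cong₂ ℕ._+_ (countBelow-∧-< p n M n≤M) (⟦∧⟧-false (p M) (dec-false (M <? n) (ℕP.≤⇒≯ n≤M))))
  (ℕP.+-identityʳ _)
  where n≤M = ℕP.m<1+n⇒m≤n (ℕP.≤∧≢⇒< n≤1+M n≢1+M)

countBelow-∧-≡-≤ : ∀ (p : ℕ → Bool) n M → M ≤ n → countBelow (λ i → p i ∧ does (i ≟ n)) M ≡ 0
countBelow-∧-≡-≤ p n zero    _     = refl
countBelow-∧-≡-≤ p n (suc M) M<n
  rewrite countBelow-∧-≡-≤ p n M (ℕP.<⇒≤ M<n) | ⟦∧⟧-false (p M) (dec-false (M ≟ n) (ℕP.<⇒≢ M<n)) = refl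

countBelow-∧-≡ : ∀ (p : ℕ → Bool) n M → n < M → countBelow (λ i → p i ∧ does (i ≟ n)) M ≡ ⟦ p n ⟧
countBelow-∧-≡ p n (suc M) (s≤s n≤M) with n ≟ M
... | yes refl rewrite countBelow-∧-≡-≤ p n n ℕP.≤-refl = ⟦∧⟧-true (p n) (dec-true (n ≟ n) refl)
... | no n≢M   = trans
  (cong₂ ℕ._+_ (countBelow-∧-≡ p n M (ℕP.≤∧≢⇒< n≤M n≢M)) (⟦∧⟧-false (p M) (dec-false (M ≟ n) (n≢M ∘ sym))))
  (ℕP.+-identityʳ _)

⟦⟧-trichotomy : ∀ b i n → ⟦ b ⟧ ≡ ⟦ b ∧ does (i <? n) ⟧ ℕ.+ (⟦ b ∧ does (i ≟ n) ⟧ ℕ.+ ⟦ b ∧ does (n <? i) ⟧)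
⟦⟧-trichotomy false i n = refl
⟦⟧-trichotomy true  i n with ℕP.<-cmp i n
... | tri< i<n i≢n i≯n rewrite dec-true (i <? n) i<n | dec-false (i ≟ n) i≢n | dec-false (n <? i) i≯n = refl
... | tri≈ i≮n i≡n i≯n rewrite dec-false (i <? n) i≮n | dec-true (i ≟ n) i≡n | dec-false (n <? i) i≯n = refl
... | tri> i≮n i≢n n<i rewrite dec-false (i <? n) i≮n | dec-false (i ≟ n) i≢n | dec-true (n <? i) n<i = refl

countBelow-∧->-element : ∀ (p : ℕ → Bool) n M → n < M → p n ≡ true →
  countBelow (λ i → p i ∧ does (n <? i)) M ≡ countBelow p M ∸ suc (countBelow p n)
countBelow-∧->-element p n M n<M pn = sym (begin
  countBelow p M ∸ suc (countBelow p n)                       ≡⟨ cong (_∸ suc (countBelow p n)) split ⟩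
  (countBelow p n ℕ.+ (1 ℕ.+ Above)) ∸ suc (countBelow p n)   ≡⟨ cong (_∸ suc (countBelow p n)) (ℕP.+-suc (countBelow p n) Above) ⟩
  (suc (countBelow p n) ℕ.+ Above) ∸ suc (countBelow p n)     ≡⟨ ℕP.m+n∸m≡n (suc (countBelow p n)) Above ⟩
  Above                                                       ∎)
  where
  open ≡-Reasoning
  Above = countBelow (λ i → p i ∧ does (n <? i)) M
  split : countBelow p M ≡ countBelow p n ℕ.+ (1 ℕ.+ Above)
  split = begin
    countBelow p M                                               ≡⟨ sumBelow-cong M (λ i _ → ⟦⟧-trichotomy (p i) i n) ⟩
    sumBelow (λ i → ⟦ p i ∧ does (i <? n) ⟧ ℕ.+ (⟦ p i ∧ does (i ≟ n) ⟧ ℕ.+ ⟦ p i ∧ does (n <? i) ⟧)) M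
      ≡⟨ trans (sumBelow-+ _ _ M) (cong (countBelow (λ i → p i ∧ does (i <? n)) M ℕ.+_) (sumBelow-+ _ _ M)) ⟩
    countBelow (λ i → p i ∧ does (i <? n)) M ℕ.+ (countBelow (λ i → p i ∧ does (i ≟ n)) M ℕ.+ Above)
      ≡⟨ cong₂ (λ a b → a ℕ.+ (b ℕ.+ Above))
           (countBelow-∧-< p n M (ℕP.<⇒≤ n<M)) (trans (countBelow-∧-≡ p n M n<M) (cong ⟦_⟧ pn)) ⟩
    countBelow p n ℕ.+ (1 ℕ.+ Above)                             ∎

countBelow-∧->-≤ : ∀ (p : ℕ → Bool) x M → M ≤ x → countBelow (λ n → p n ∧ does (x <? n)) M ≡ 0
countBelow-∧->-≤ p x zero    _     = refl
countBelow-∧->-≤ p x (suc M) M<x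
  rewrite countBelow-∧->-≤ p x M (ℕP.<⇒≤ M<x) | ⟦∧⟧-false (p M) (dec-false (x <? M) (ℕP.≤⇒≯ (ℕP.<⇒≤ M<x))) = refl

countBelow-∧-<-≥ : ∀ (p : ℕ → Bool) x M → M ≤ x → countBelow p M ≡ countBelow (λ n → p n ∧ does (n <? x)) M
countBelow-∧-<-≥ p x M M≤x =
  sumBelow-cong M (λ i i<M → sym (⟦∧⟧-true (p i) (dec-true (i <? x) (ℕP.<-≤-trans i<M M≤x))))

-- Reindexes the sum over the p-elements above x by their rank counted from the top.
sumBelow-ranks-above : ∀ (p : ℕ → Bool) x (g : ℕ → ℕ) M →
  sumBelow (λ n → if p n ∧ does (x <? n) then g (countBelow p n) else 0) M ≡
  sumBelow (λ k → g (countBelow p M ∸ suc k)) (countBelow (λ n → p n ∧ does (x <? n)) M)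
sumBelow-ranks-above p x g zero    = refl
-- does (x <? M) computes to x <ᵇ M, so the case split is on the latter.
sumBelow-ranks-above p x g (suc M) with p M | x ℕ.<ᵇ M | ℕP.<ᵇ-reflects-< x M
... | false | _ | _ = begin
  S ℕ.+ 0                                           ≡⟨ ℕP.+-identityʳ S ⟩
  S                                                 ≡⟨ sumBelow-ranks-above p x g M ⟩
  sumBelow (λ k → g (countBelow p M ∸ suc k)) A
    ≡⟨ cong₂ (λ c a → sumBelow (λ k → g (c ∸ suc k)) a) (ℕP.+-identityʳ (countBelow p M)) (ℕP.+-identityʳ A) ⟨
  sumBelow (λ k → g (countBelow p M ℕ.+ 0 ∸ suc k)) (A ℕ.+ 0) ∎
  where
  open ≡-Reasoning
  S = sumBelow (λ n → if p n ∧ does (x <? n) then g (countBelow p n) else 0) M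
  A = countBelow (λ n → p n ∧ does (x <? n)) M
... | true | false | ofⁿ x≮M = begin
  S ℕ.+ 0                                           ≡⟨ ℕP.+-identityʳ S ⟩
  S                                                 ≡⟨ sumBelow-ranks-above p x g M ⟩
  sumBelow (λ k → g (countBelow p M ∸ suc k)) A     ≡⟨ cong (sumBelow (λ k → g (countBelow p M ∸ suc k))) A≡0 ⟩
  0
    ≡⟨ cong (sumBelow (λ k → g (countBelow p M ℕ.+ 1 ∸ suc k))) (trans (ℕP.+-identityʳ A) A≡0) ⟨
  sumBelow (λ k → g (countBelow p M ℕ.+ 1 ∸ suc k)) (A ℕ.+ 0) ∎
  where
  open ≡-Reasoning
  S = sumBelow (λ n → if p n ∧ does (x <? n) then g (countBelow p n) else 0) M
  A = countBelow (λ n → p n ∧ does (x <? n)) M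
  A≡0 = countBelow-∧->-≤ p x M (ℕP.≮⇒≥ x≮M)
... | true | true | ofʸ _ = begin
  S ℕ.+ g (countBelow p M)                                     ≡⟨ cong (ℕ._+ g (countBelow p M)) (sumBelow-ranks-above p x g M) ⟩
  sumBelow (λ k → g (countBelow p M ∸ suc k)) A ℕ.+ g (countBelow p M)  ≡⟨ ℕP.+-comm _ (g (countBelow p M)) ⟩
  g (countBelow p M) ℕ.+ sumBelow (λ k → g (countBelow p M ∸ suc k)) A  ≡⟨ sumBelow-split-head (λ k → g (suc (countBelow p M) ∸ suc k)) A ⟨
  sumBelow (λ k → g (suc (countBelow p M) ∸ suc k)) (suc A)
    ≡⟨ cong₂ (λ c a → sumBelow (λ k → g (c ∸ suc k)) a) (ℕP.+-comm 1 (countBelow p M)) (ℕP.+-comm 1 A) ⟩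
  sumBelow (λ k → g (countBelow p M ℕ.+ 1 ∸ suc k)) (A ℕ.+ 1) ∎
  where
  open ≡-Reasoning
  S = sumBelow (λ n → if p n ∧ does (x <? n) then g (countBelow p n) else 0) M
  A = countBelow (λ n → p n ∧ does (x <? n)) M

sumBelow-ranks-below : ∀ (p : ℕ → Bool) x (h : ℕ → ℕ) M →
  sumBelow (λ n → if p n ∧ does (n <? x) then h (countBelow p n) else 0) M ≡
  sumBelow h (countBelow (λ n → p n ∧ does (n <? x)) M)
sumBelow-ranks-below p x h zero    = refl
sumBelow-ranks-below p x h (suc M) with p M | M ℕ.<ᵇ x | ℕP.<ᵇ-reflects-< M x
... | false | _ | _ = trans (ℕP.+-identityʳ _)
  (trans (sumBelow-ranks-below p x h M) (cong (sumBelow h) (sym (ℕP.+-identityʳ (countBelow (λ n → p n ∧ does (n <? x)) M)))))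
... | true | false | _ = trans (ℕP.+-identityʳ _)
  (trans (sumBelow-ranks-below p x h M) (cong (sumBelow h) (sym (ℕP.+-identityʳ (countBelow (λ n → p n ∧ does (n <? x)) M)))))
... | true | true | ofʸ M<x = trans
  (cong₂ ℕ._+_ (sumBelow-ranks-below p x h M) (cong h (countBelow-∧-<-≥ p x M (ℕP.<⇒≤ M<x))))
  (cong (sumBelow h) (ℕP.+-comm 1 (countBelow (λ n → p n ∧ does (n <? x)) M)))

ZigzagStep : Bool → ℕ → ℕ → Set
ZigzagStep true  x n = x < n
ZigzagStep false x n = n < x

zigzagStep? : ∀ d x n → Dec (ZigzagStep d x n)
zigzagStep? true  x n = x <? n
zigzagStep? false x n = n <? x

entringer-suc-by-first-step : ∀ (p : ℕ → Bool) M L x d → countBelow p M ≡ suc L →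
  sumBelow (λ n → if p n ∧ does (zigzagStep? d x n)
                  then entringer L (countBelow (λ n′ → p n′ ∧ does (zigzagStep? (not d) n n′)) M) else 0) M
  ≡ entringer (suc L) (countBelow (λ n → p n ∧ does (zigzagStep? d x n)) M)
entringer-suc-by-first-step p M L x true #p≡1+L = begin
  sumBelow (λ n → if p n ∧ does (x <? n) then entringer L (countBelow (λ n′ → p n′ ∧ does (n′ <? n)) M) else 0) M
    ≡⟨ sumBelow-cong M (λ n n<M → cong (λ c → if p n ∧ does (x <? n) then entringer L c else 0)
                                       (countBelow-∧-< p n M (ℕP.<⇒≤ n<M))) ⟩
  sumBelow (λ n → if p n ∧ does (x <? n) then entringer L (countBelow p n) else 0) M
    ≡⟨ sumBelow-ranks-above p x (entringer L) M ⟩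
  sumBelow (λ k → entringer L (countBelow p M ∸ suc k)) (countBelow (λ n → p n ∧ does (x <? n)) M)
    ≡⟨ cong (λ c → sumBelow (λ k → entringer L (c ∸ suc k)) (countBelow (λ n → p n ∧ does (x <? n)) M)) #p≡1+L ⟩
  entringer (suc L) (countBelow (λ n → p n ∧ does (x <? n)) M) ∎
  where open ≡-Reasoning
entringer-suc-by-first-step p M L x false #p≡1+L = begin
  sumBelow (λ n → if p n ∧ does (n <? x) then entringer L (countBelow (λ n′ → p n′ ∧ does (n <? n′)) M) else 0) M
    ≡⟨ sumBelow-cong M above ⟩
  sumBelow (λ n → if p n ∧ does (n <? x) then entringer L (countBelow p M ∸ suc (countBelow p n)) else 0) M
    ≡⟨ sumBelow-ranks-below p x (λ c → entringer L (countBelow p M ∸ suc c)) M ⟩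
  sumBelow (λ k → entringer L (countBelow p M ∸ suc k)) (countBelow (λ n → p n ∧ does (n <? x)) M)
    ≡⟨ cong (λ c → sumBelow (λ k → entringer L (c ∸ suc k)) (countBelow (λ n → p n ∧ does (n <? x)) M)) #p≡1+L ⟩
  entringer (suc L) (countBelow (λ n → p n ∧ does (n <? x)) M) ∎
  where
  open ≡-Reasoning
  above : ∀ n → n < M →
    (if p n ∧ does (n <? x) then entringer L (countBelow (λ n′ → p n′ ∧ does (n <? n′)) M) else 0) ≡
    (if p n ∧ does (n <? x) then entringer L (countBelow p M ∸ suc (countBelow p n)) else 0)
  above n n<M with p n in pn
  ... | false = refl
  ... | true  = cong (λ c → if does (n <? x) then entringer L c else 0) (countBelow-∧->-element p n M n<M pn)

≡ᵇ-reflects-≡ : ∀ m n → Reflects (m ≡ n) (m ℕ.≡ᵇ n)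
≡ᵇ-reflects-≡ m n = fromEquivalence (ℕP.≡ᵇ⇒≡ m n) (ℕP.≡⇒≡ᵇ m n)

Zigzag : Bool → List ℕ → Set
Zigzag true  = Up
Zigzag false = Down

zigzag? : ∀ d xs → Dec (Zigzag d xs)
zigzag? true  = up?
zigzag? false = down?

zigzag-∷ : ∀ d x n r → Zigzag d (x ∷ n ∷ r) ⇔ (ZigzagStep d x n × Zigzag (not d) (n ∷ r))
zigzag-∷ true  x n r = mk⇔ id id
zigzag-∷ false x n r = mk⇔ id id

module _ (m : ℕ) where

  available : List (Fin m) → ℕ → Bool
  available []      n = true
  available (u ∷ U) n = not (toℕ u ℕ.≡ᵇ n) ∧ available U n

  available⇒∉ : ∀ U {y} → T (available U (toℕ y)) → y ∉ U
  available⇒∉ (u ∷ U) {y} t y∈u∷U with toℕ u ℕ.≡ᵇ toℕ y | ≡ᵇ-reflects-≡ (toℕ u) (toℕ y)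
  ... | true  | _       = ⊥-elim t
  ... | false | ofⁿ u≢y with y∈u∷U
  ...   | here y≡u  = u≢y (cong toℕ (sym y≡u))
  ...   | there y∈U = available⇒∉ U t y∈U

  ∉⇒available : ∀ U {y} → y ∉ U → T (available U (toℕ y))
  ∉⇒available []      y∉U = tt
  ∉⇒available (u ∷ U) {y} y∉u∷U with toℕ u ℕ.≡ᵇ toℕ y | ≡ᵇ-reflects-≡ (toℕ u) (toℕ y)
  ... | true  | ofʸ u≡y = y∉u∷U (here (FP.toℕ-injective (sym u≡y)))
  ... | false | _       = ∉⇒available U (y∉u∷U ∘ there)

  -- Decided through available, so that does (y ∉? U) is available U (toℕ y) by definition.
  _∉?_ : ∀ y U → Dec (y ∉ U)
  y ∉? U = map′ (available⇒∉ U) (∉⇒available U) (T? (available U (toℕ y)))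

  -- w can follow a zigzag word that uses the letters U and ends in x, its next step going up iff d.
  Continues : List (Fin m) → ℕ → Bool → List (Fin m) → Set
  Continues U x d w = Unique w × All (_∉ U) w × Zigzag d (x ∷ map toℕ w)

  continues? : ∀ U x d w → Dec (Continues U x d w)
  continues? U x d w = unique? FP._≟_ w ×-dec all? (_∉? U) w ×-dec zigzag? d (x ∷ map toℕ w)

  continuations : List (Fin m) → ℕ → Bool → ℕ → ℕ
  continuations U x d L = length (filter (continues? U x d) (words (allFin m) L))

  firstStep? : ∀ U x d (y : Fin m) → Dec (y ∉ U × ZigzagStep d x (toℕ y))
  firstStep? U x d y = (y ∉? U) ×-dec zigzagStep? d x (toℕ y)

  ∉-∷⁻ : ∀ {y z : Fin m} {U} → z ∉ y ∷ U → y ≢ z × z ∉ U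
  ∉-∷⁻ z∉y∷U = (λ y≡z → z∉y∷U (here (sym y≡z))) , z∉y∷U ∘ there

  ∉-∷⁺ : ∀ {y z : Fin m} {U} → y ≢ z × z ∉ U → z ∉ y ∷ U
  ∉-∷⁺ (y≢z , z∉U) (here z≡y)   = y≢z (sym z≡y)
  ∉-∷⁺ (y≢z , z∉U) (there z∈U) = z∉U z∈U

  continues-∷ : ∀ U x d y w → Continues U x d (y ∷ w) ⇔
                ((y ∉ U × ZigzagStep d x (toℕ y)) × Continues (y ∷ U) (toℕ y) (not d) w)
  continues-∷ U x d y w = mk⇔
    (λ { (y∉w ∷ unique-w , y∉U ∷ w∉U , zigzag) →
         let (step , zigzag′) = Equivalence.to (zigzag-∷ d x (toℕ y) (map toℕ w)) zigzag
         in (y∉U , step) , unique-w , All.zipWith ∉-∷⁺ (y∉w , w∉U) , zigzag′ })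
    (λ { ((y∉U , step) , unique-w , w∉y∷U , zigzag′) →
         let (y∉w , w∉U) = All.unzipWith ∉-∷⁻ w∉y∷U
         in y∉w ∷ unique-w , y∉U ∷ w∉U , Equivalence.from (zigzag-∷ d x (toℕ y) (map toℕ w)) (step , zigzag′) })

  continuations-suc : ∀ U x d L → continuations U x d (suc L) ≡
    sum (map (λ y → if does (firstStep? U x d y) then continuations (y ∷ U) (toℕ y) (not d) L else 0) (allFin m))
  continuations-suc U x d L = trans
    (length-filter-concatMap (continues? U x d) (λ y → map (y ∷_) (words (allFin m) L)) (allFin m))
    (cong sum (LP.map-cong byFirstLetter (allFin m)))
    where
    byFirstLetter : ∀ y → length (filter (continues? U x d) (map (y ∷_) (words (allFin m) L))) ≡
                          (if does (firstStep? U x d y) then continuations (y ∷ U) (toℕ y) (not d) L else 0)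
    byFirstLetter y = begin
      length (filter (continues? U x d) (map (y ∷_) ws))                     ≡⟨ length-filter-map (continues? U x d) (y ∷_) ws ⟩
      length (filter (continues? U x d ∘ (y ∷_)) ws)
        ≡⟨ cong length (LP.filter-≐ _ (λ w → firstStep? U x d y ×-dec continues? (y ∷ U) (toℕ y) (not d) w)
             (Equivalence.to (continues-∷ U x d y _) , Equivalence.from (continues-∷ U x d y _)) ws) ⟩
      length (filter (λ w → firstStep? U x d y ×-dec continues? (y ∷ U) (toℕ y) (not d) w) ws)
        ≡⟨ length-filter-×-dec (firstStep? U x d y) (continues? (y ∷ U) (toℕ y) (not d)) ws ⟩
      (if does (firstStep? U x d y) then continuations (y ∷ U) (toℕ y) (not d) L else 0) ∎
      where
      open ≡-Reasoning
      ws = words (allFin m) L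

  ≡ᵇ-refl : ∀ n → (n ℕ.≡ᵇ n) ≡ true
  ≡ᵇ-refl n = dec-true (n ℕ.≟ n) refl

  ≢⇒≡ᵇ≡false : ∀ {i n} → i ≢ n → (i ℕ.≡ᵇ n) ≡ false
  ≢⇒≡ᵇ≡false i≢n = dec-false (_ ℕ.≟ _) i≢n

  ⟦available⟧-∷ : ∀ y U n → ⟦ available U n ⟧ ≡ ⟦ available (y ∷ U) n ⟧ ℕ.+ ⟦ available U n ∧ does (n ℕ.≟ toℕ y) ⟧
  ⟦available⟧-∷ y U n with n ℕ.≟ toℕ y
  ... | yes refl rewrite ≡ᵇ-refl (toℕ y) = sym (⟦∧⟧-true (available U (toℕ y)) refl)
  ... | no n≢y   rewrite ≢⇒≡ᵇ≡false (n≢y ∘ sym) | ≢⇒≡ᵇ≡false n≢y =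
    sym (trans (cong (⟦ available U n ⟧ ℕ.+_) (⟦∧⟧-false (available U n) refl)) (ℕP.+-identityʳ _))

  countBelow-available-∷ : ∀ y U → available U (toℕ y) ≡ true →
    countBelow (available U) m ≡ suc (countBelow (available (y ∷ U)) m)
  countBelow-available-∷ y U y-available = begin
    countBelow (available U) m                      ≡⟨ sumBelow-cong m (λ n _ → ⟦available⟧-∷ y U n) ⟩
    sumBelow (λ n → ⟦ available (y ∷ U) n ⟧ ℕ.+ ⟦ available U n ∧ does (n ℕ.≟ toℕ y) ⟧) m    ≡⟨ sumBelow-+ _ _ m ⟩
    countBelow (available (y ∷ U)) m ℕ.+ countBelow (λ n → available U n ∧ does (n ℕ.≟ toℕ y)) m
      ≡⟨ cong (countBelow (available (y ∷ U)) m ℕ.+_)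
           (trans (countBelow-∧-≡ (available U) (toℕ y) m (FP.toℕ<n y)) (cong ⟦_⟧ y-available)) ⟩
    countBelow (available (y ∷ U)) m ℕ.+ 1          ≡⟨ ℕP.+-comm _ 1 ⟩
    suc (countBelow (available (y ∷ U)) m)          ∎
    where open ≡-Reasoning

  zigzagStep-irrefl : ∀ d c → does (zigzagStep? d c c) ≡ false
  zigzagStep-irrefl true  c = dec-false (c <? c) (ℕP.<-irrefl refl)
  zigzagStep-irrefl false c = dec-false (c <? c) (ℕP.<-irrefl refl)

  countBelow-zigzagStep-available-∷ : ∀ y U d →
    countBelow (λ n → available (y ∷ U) n ∧ does (zigzagStep? d (toℕ y) n)) m ≡
    countBelow (λ n → available U n ∧ does (zigzagStep? d (toℕ y) n)) m
  countBelow-zigzagStep-available-∷ y U d = sumBelow-cong m (λ n _ → pointwise n)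
    where
    pointwise : ∀ n → ⟦ available (y ∷ U) n ∧ does (zigzagStep? d (toℕ y) n) ⟧ ≡
                      ⟦ available U n ∧ does (zigzagStep? d (toℕ y) n) ⟧
    pointwise n with n ℕ.≟ toℕ y
    ... | yes refl = trans (⟦∧⟧-false _ (zigzagStep-irrefl d n)) (sym (⟦∧⟧-false _ (zigzagStep-irrefl d n)))
    ... | no n≢y rewrite ≢⇒≡ᵇ≡false (n≢y ∘ sym) = refl

  continuations≡entringer : ∀ L U x d → countBelow (available U) m ≡ L →
    continuations U x d L ≡ entringer L (countBelow (λ n → available U n ∧ does (zigzagStep? d x n)) m)
  continuations≡entringer zero    U x true  _ = refl
  continuations≡entringer zero    U x false _ = refl
  continuations≡entringer (suc L) U x d #U≡1+L = begin
    continuations U x d (suc L)                                   ≡⟨ continuations-suc U x d L ⟩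
    sum (map (λ y → if does (firstStep? U x d y) then continuations (y ∷ U) (toℕ y) (not d) L else 0) (allFin m))
      ≡⟨ cong sum (LP.map-cong byFirstLetter (allFin m)) ⟩
    sum (map (G ∘ toℕ) (allFin m))                                ≡⟨ sum-allFin m G ⟩
    sumBelow G m                                                  ≡⟨ entringer-suc-by-first-step (available U) m L x d #U≡1+L ⟩
    entringer (suc L) (countBelow (λ n → available U n ∧ does (zigzagStep? d x n)) m) ∎
    where
    open ≡-Reasoning
    G : ℕ → ℕ
    G n = if available U n ∧ does (zigzagStep? d x n)
          then entringer L (countBelow (λ n′ → available U n′ ∧ does (zigzagStep? (not d) n n′)) m) else 0
    byFirstLetter : ∀ y → (if does (firstStep? U x d y) then continuations (y ∷ U) (toℕ y) (not d) L else 0) ≡ G (toℕ y)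
    byFirstLetter y with available U (toℕ y) in y-available
    ... | false = refl
    ... | true  = cong (λ c → if does (zigzagStep? d x (toℕ y)) then c else 0) (begin
      continuations (y ∷ U) (toℕ y) (not d) L
        ≡⟨ continuations≡entringer L (y ∷ U) (toℕ y) (not d)
             (ℕP.suc-injective (trans (sym (countBelow-available-∷ y U y-available)) #U≡1+L)) ⟩
      entringer L (countBelow (λ n → available (y ∷ U) n ∧ does (zigzagStep? (not d) (toℕ y) n)) m)
        ≡⟨ cong (entringer L) (countBelow-zigzagStep-available-∷ y U (not d)) ⟩
      entringer L (countBelow (λ n → available U n ∧ does (zigzagStep? (not d) (toℕ y) n)) m) ∎)

E≡entringer : ∀ m → E m ≡ entringer m m
E≡entringer m = begin
  length (filter (isAltPerm? m) (words (allFin m) m))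
    ≡⟨ cong length (LP.filter-≐ (isAltPerm? m) (continues? m [] m false) (toContinues , fromContinues) (words (allFin m) m)) ⟩
  continuations m [] m false m                                 ≡⟨ continuations≡entringer m m [] m false (countBelow-all m) ⟩
  entringer m (countBelow (λ n → true ∧ does (n <? m)) m)      ≡⟨ cong (entringer m) (countBelow-∧-< (λ _ → true) m m ℕP.≤-refl) ⟩
  entringer m (countBelow (λ _ → true) m)                      ≡⟨ cong (entringer m) (countBelow-all m) ⟩
  entringer m m                                                ∎
  where
  open ≡-Reasoning
  -- σ is alternating iff m σ(1) σ(2) … is a zigzag word starting downwards, as σ(1) < m.
  belowTop : ∀ (σ : List (Fin m)) → Up (map toℕ σ) → Down (m ∷ map toℕ σ)
  belowTop []      _  = tt
  belowTop (y ∷ σ) up = FP.toℕ<n y , up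
  toContinues : ∀ {σ} → IsAltPerm m σ → Continues m [] m false σ
  toContinues {σ} (unique , up) = unique , All.universal (λ _ ()) σ , belowTop σ up
  fromContinues : ∀ {σ} → Continues m [] m false σ → IsAltPerm m σ
  fromContinues {[]}    (unique , _ , _)             = unique , tt
  fromContinues {y ∷ σ} (unique , _ , (_ , up))      = unique , up


eulerRatio≡seidelCoeff : ∀ k → eulerRatio k ≡ seidelCoeff 0 k
eulerRatio≡seidelCoeff k = begin
  (+ E k / k !) {{k ℕP.!≢0}}                  ≡⟨ cong (λ e → (+ e / k !) {{k ℕP.!≢0}}) (E≡entringer k) ⟩
  (+ seidel 0 k / k !) {{k ℕP.!≢0}}           ≡⟨ x/n!≡x*invFactorial (seidel 0 k) k ⟩
  fromℕ (seidel 0 k) ℚ.* invFactorial k       ≡⟨ cong (ℚ._* invFactorial k) (ℚP.*-identityʳ (fromℕ (seidel 0 k))) ⟨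
  seidelCoeff 0 k                             ∎
  where open ≡-Reasoning

-- The identity also holds for n = 0, where both sides are 1.
corollary1p6 : (n : ℕ) → n ≥ 1 → sumℚ (map weight (Dyck n)) ≡ eulerRatio (suc (2 * n))
corollary1p6 n _ = begin
  sumℚ (map weight (Dyck n))                      ≡⟨ sum-weight-Dyck n ⟩
  pathSum 0 (2 * n)                               ≡⟨ cong (pathSum 0) 2n≡n+n ⟩
  dyckSum n
    ≡⟨ TangentRecurrence-unique {dyckSum} {oddEulerRatio} refl dyckSum-tangent oddEulerRatio-tangent n ⟩
  oddEulerRatio n                                 ≡⟨ cong (seidelCoeff 0 ∘ suc) 2n≡n+n ⟨
  seidelCoeff 0 (suc (2 * n))                     ≡⟨ eulerRatio≡seidelCoeff (suc (2 * n)) ⟨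
  eulerRatio (suc (2 * n))                        ∎
  where
  open ≡-Reasoning
  2n≡n+n : 2 * n ≡ n ℕ.+ n
  2n≡n+n = cong (n ℕ.+_) (ℕP.+-identityʳ n)
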